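{- Let $G$ be a finite simple graph of order $2n$ with a perfect matching. Then $$f(G)\geq n-\frac{1}{2}-\sqrt{2n^2-n-e(G)+\frac{1}{4}},$$ and equality holds if and only if $G$ is isomorphic to $\hat{H}_{n-k,0}\vee K_{2k}$ for some integer $0\leq k\leq n-1$.
   Context: For a graph $G$ with a perfect matching $M$, a subset $S\subseteq M$ is a forcing set of $M$ if $S$ is contained in no perfect matching of $G$ other than $M$. $f(G,M)$ is the minimum size of a forcing set of $M$, and $f(G)=\min_M f(G,M)$ over all perfect matchings $M$ of $G$. $e(G)$ denotes the number of edges. For $m\geq 1$, $H_{m,0}$ is the bipartite graph with parts $U=\{u_1,\dots,u_m\}$, $V=\{v_1,\dots,v_m\}$ in which $u_iv_j$ is an edge if and only if $i\geq j$; $\hat{H}_{m,0}$ is obtained from $H_{m,0}$ by adding all edges between pairs of vertices of $V$. $K_{2k}$ is the complete graph on $2k$ vertices ($K_0$ is empty). The join $G\vee H$ is the disjoint union of $G$ and $H$ together with all edges between $V(G)$ and $V(H)$. -}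

module Defs where

open import Data.Nat using (ℕ; zero; suc; _+_; _*_; _∸_; _^_; _≤_; _<_; _≥_; _≤ᵇ_; _≡ᵇ_)
open import Data.Fin using (Fin; toℕ; splitAt)
open import Data.Fin.Subset using (Subset; _∈_; ∣_∣)
open import Data.Bool using (Bool; true; false; not; _∧_; if_then_else_)
open import Data.Sum using (_⊎_; inj₁; inj₂)
open import Data.Product using (Σ; ∃; _×_; _,_)
open import Function.Bundles using (_↔_; Inverse)
open import Relation.Binary.PropositionalEquality using (_≡_; _≢_)

Graph : ℕ → Set
Graph m = Fin m → Fin m → Bool

record IsSimple {m : ℕ} (G : Graph m) : Set where
  field
    sym    : ∀ i j → G i j ≡ G j i
    irrefl : ∀ i → G i i ≡ false

∑ : {m : ℕ} → (Fin m → ℕ) → ℕ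
∑ {zero}  f = 0
∑ {suc m} f = f Fin.zero + ∑ (λ i → f (Fin.suc i))

boolToℕ : Bool → ℕ
boolToℕ true  = 1
boolToℕ false = 0

edgeCount : {m : ℕ} → Graph m → ℕ
edgeCount G = ∑ λ i → ∑ λ j → boolToℕ ((suc (toℕ i) ≤ᵇ toℕ j) ∧ G i j)

record PerfectMatching {m : ℕ} (G : Graph m) : Set where
  field
    partner : Fin m → Fin m
    invol   : ∀ u → partner (partner u) ≡ u
    nofix   : ∀ u → partner u ≢ u
    edge    : ∀ u → G u (partner u) ≡ true
open PerfectMatching public

-- A subset S ⊆ M of matching edges is represented by the set of vertices it
-- covers, which must be closed under the partner map.
SubsetOfMatching : {m : ℕ} {G : Graph m} → PerfectMatching G → Subset m → Set
SubsetOfMatching M T = ∀ u → u ∈ T → partner M u ∈ T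

edgesOf : {m : ℕ} {G : Graph m} → PerfectMatching G → Subset m → ℕ
edgesOf {m} M T = ∑ λ u → boolToℕ (memb u T ∧ (suc (toℕ u) ≤ᵇ toℕ (partner M u)))
  where
    open import Data.Vec using (lookup)
    memb : Fin m → Subset m → Bool
    memb u T = lookup T u

IsForcingSet : {m : ℕ} {G : Graph m} → PerfectMatching G → Subset m → Set
IsForcingSet {G = G} M T =
  SubsetOfMatching M T ×
  ((M′ : PerfectMatching G) → (∀ u → u ∈ T → partner M′ u ≡ partner M u) →
     ∀ u → partner M′ u ≡ partner M u)

IsForcingNumberOf : {m : ℕ} {G : Graph m} → PerfectMatching G → ℕ → Set
IsForcingNumberOf M k =
  (Σ _ λ T → IsForcingSet M T × edgesOf M T ≡ k) ×
  (∀ T → IsForcingSet M T → k ≤ edgesOf M T)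

IsForcingNumber : {m : ℕ} → Graph m → ℕ → Set
IsForcingNumber G k =
  (Σ (PerfectMatching G) λ M → IsForcingNumberOf M k) ×
  (∀ (M : PerfectMatching G) k′ → IsForcingNumberOf M k′ → k ≤ k′)

_≅_ : {a b : ℕ} → Graph a → Graph b → Set
_≅_ {a} {b} G H = Σ (Fin a ↔ Fin b) λ φ →
  ∀ i j → G i j ≡ H (Inverse.to φ i) (Inverse.to φ j)

-- Ĥ_{m,0}: vertices Fin (m + m); the first block is U = {u_0..u_{m-1}},
-- the second block is V = {v_0..v_{m-1}}; u_i v_j an edge iff i ≥ j,
-- all pairs of distinct vertices of V adjacent, U independent.
Hhat : (m : ℕ) → Graph (m + m)
Hhat m x y with splitAt m x | splitAt m y
... | inj₁ i | inj₁ j = false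
... | inj₁ i | inj₂ j = toℕ j ≤ᵇ toℕ i
... | inj₂ j | inj₁ i = toℕ j ≤ᵇ toℕ i
... | inj₂ i | inj₂ j = not (toℕ i ≡ᵇ toℕ j)

Complete : (r : ℕ) → Graph r
Complete r i j = not (toℕ i ≡ᵇ toℕ j)

join : {a b : ℕ} → Graph a → Graph b → Graph (a + b)
join {a} G H x y with splitAt a x | splitAt a y
... | inj₁ i | inj₁ j = G i j
... | inj₂ i | inj₂ j = H i j
... | inj₁ _ | inj₂ _ = true
... | inj₂ _ | inj₁ _ = true

-- The bound  f ≥ n - 1/2 - √(2n² - n - e + 1/4)  stated without reals.
-- Since f is an integer:  if f ≥ n it holds trivially; otherwise both sides
-- n - 1/2 - f > 0 and we square and multiply by 4:
--   (2n - 1 - 2f)² ≤ 8n² - 4n - 4e + 1 ,  i.e.  (2n-1-2f)² + 4e ≤ 4n(2n-1) + 1.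
BoundHolds : (n e f : ℕ) → Set
BoundHolds n e f =
  n ≤ f ⊎ ((2 * n ∸ (1 + 2 * f)) ^ 2 + 4 * e ≤ 4 * n * (2 * n ∸ 1) + 1)

-- equality  f = n - 1/2 - √(...)  ⇔  n - 1/2 - f ≥ 0 (i.e. f < n) and squares agree
BoundTight : (n e f : ℕ) → Set
BoundTight n e f =
  f < n × ((2 * n ∸ (1 + 2 * f)) ^ 2 + 4 * e ≡ 4 * n * (2 * n ∸ 1) + 1)

module Submission where

-- Let S be a forcing set of a perfect matching M, with t edges covering the vertex set T, and let
-- O be the remaining 2(n - t) vertices.  Conjugating M by a permutation of O that fixes T yields
-- another perfect matching containing S, so G has no M-alternating 4- or 6-cycle inside O; in
-- particular for x, y ∈ O with y ∉ {x, Mx} at most one of xy, MxMy is an edge.  Summing over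
-- ordered pairs of vertices gives the identity (2n - 1 - 2t)² + 4e + g = 4n(2n - 1) + 1, where
-- g ≥ 0 counts the missing edges at T and the pairs in O with neither xy nor MxMy; this is the
-- bound.  Equality means g = 0: T is joined to everything and exactly one of xy, MxMy is present.
-- Then the O-degrees of the ends of an M-edge add up to |O|, and the 6-cycle condition makes the
-- O-degree of an edge's end exceed that of the other end's partner, which lays O out as the two
-- sides of Ĥ_{n-t,0}.  Conversely, in Ĥ_{m,0} ∨ K_{2k} the matching u_i v_i together with any
-- perfect matching of K_{2k} is forced by its k edges in K_{2k}, and attains equality.

open import Defs
open import Data.Nat
open import Data.Nat.Properties
open import Data.Nat.Tactic.RingSolver
open import Data.Bool using (Bool; true; false; not; _∧_; _∨_; if_then_else_; T)
open import Data.Bool.Properties using (∧-idem; ∧-zeroʳ)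
open import Data.Fin using (Fin; toℕ; zero; suc; fromℕ<; splitAt; _↑ˡ_; _↑ʳ_; punchOut)
import Data.Fin.Properties as FP
open import Data.Fin.Subset using (Subset; _∈_)
open import Data.Vec using (lookup; tabulate)
open import Data.Vec.Properties using ([]=⇒lookup; lookup⇒[]=; lookup∘tabulate)
open import Data.Product using (Σ; _×_; _,_; proj₁; proj₂)
open import Data.Sum using (_⊎_; inj₁; inj₂)
open import Function.Bundles using (_↔_; Inverse; mk↔ₛ′; _⇔_; mk⇔)
open import Relation.Binary.PropositionalEquality
open import Relation.Nullary using (¬_; yes; no; Dec)
open import Data.Empty using (⊥; ⊥-elim)
open import Relation.Binary.Definitions using (tri<; tri≈; tri>)
import Algebra.Properties.CommutativeMonoid.Sum as CMS

∑-cong : ∀ {m} {f g : Fin m → ℕ} → (∀ i → f i ≡ g i) → ∑ f ≡ ∑ g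
∑-cong {zero} e = refl
∑-cong {suc m} e = cong₂ _+_ (e zero) (∑-cong (λ i → e (suc i)))

∑-mono : ∀ {m} {f g : Fin m → ℕ} → (∀ i → f i ≤ g i) → ∑ f ≤ ∑ g
∑-mono {zero} e = z≤n
∑-mono {suc m} e = +-mono-≤ (e zero) (∑-mono (λ i → e (suc i)))

module SumMonoid = CMS +-0-commutativeMonoid

∑≡sum : ∀ {m} (f : Fin m → ℕ) → ∑ f ≡ SumMonoid.sum f
∑≡sum {zero} f = refl
∑≡sum {suc m} f = cong (f zero +_) (∑≡sum (λ i → f (suc i)))

∑-+ : ∀ {m} (f g : Fin m → ℕ) → ∑ (λ i → f i + g i) ≡ ∑ f + ∑ g
∑-+ f g = trans (∑≡sum (λ i → f i + g i)) (trans (SumMonoid.∑-distrib-+ f g) (sym (cong₂ _+_ (∑≡sum f) (∑≡sum g))))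

∑-*ˡ : ∀ {m} c (f : Fin m → ℕ) → ∑ (λ i → c * f i) ≡ c * ∑ f
∑-*ˡ {zero} c f = sym (*-zeroʳ c)
∑-*ˡ {suc m} c f = trans (cong (c * f zero +_) (∑-*ˡ c (λ i → f (suc i)))) (sym (*-distribˡ-+ c (f zero) _))

∑-0 : ∀ {m} → ∑ {m} (λ _ → 0) ≡ 0
∑-0 {zero} = refl
∑-0 {suc m} = ∑-0 {m}

∑-1 : ∀ {m} → ∑ {m} (λ _ → 1) ≡ m
∑-1 {zero} = refl
∑-1 {suc m} = cong suc (∑-1 {m})

∑-swap : ∀ {m n} (f : Fin m → Fin n → ℕ) → ∑ (λ i → ∑ (λ j → f i j)) ≡ ∑ (λ j → ∑ (λ i → f i j))
∑-swap {zero} {n} f = sym (∑-0 {n})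
∑-swap {suc m} {n} f = trans (cong (∑ (f zero) +_) (∑-swap (λ i → f (suc i)))) (sym (∑-+ (f zero) (λ j → ∑ (λ i → f (suc i) j))))

∑≡0⇒≡0 : ∀ {m} (f : Fin m → ℕ) → ∑ f ≡ 0 → ∀ i → f i ≡ 0
∑≡0⇒≡0 {suc m} f e zero = m+n≡0⇒m≡0 (f zero) e
∑≡0⇒≡0 {suc m} f e (suc i) = ∑≡0⇒≡0 (λ i → f (suc i)) (m+n≡0⇒n≡0 (f zero) e) i

term≤∑ : ∀ {m} (f : Fin m → ℕ) (i : Fin m) → f i ≤ ∑ f
term≤∑ f zero = m≤m+n _ _
term≤∑ f (suc i) = ≤-trans (term≤∑ (λ j → f (suc j)) i) (m≤n+m _ (f zero))

∑-splitAt : ∀ a {b} (f : Fin (a + b) → ℕ) → ∑ f ≡ ∑ (λ i → f (i ↑ˡ b)) + ∑ (λ j → f (a ↑ʳ j))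
∑-splitAt zero f = refl
∑-splitAt (suc a) f = trans (cong (f zero +_) (∑-splitAt a (λ i → f (suc i)))) (sym (+-assoc (f zero) _ _))

∑-permute : ∀ {m n} (π : Fin m ↔ Fin n) (f : Fin n → ℕ) → ∑ (λ i → f (Inverse.to π i)) ≡ ∑ f
∑-permute π f = trans (∑≡sum (λ i → f (Inverse.to π i))) (trans (sym (SumMonoid.sum-permute f π)) (sym (∑≡sum f)))


-- A forcing set admits no alternating 4- and 6-cycles

false≢true : false ≢ true
false≢true ()

swap : ∀ {N} → Fin N → Fin N → Fin N → Fin N
swap a b x with x FP.≟ a
... | yes _ = b
... | no _ with x FP.≟ b
... | yes _ = a
... | no _ = x

swap-≡ˡ : ∀ {N} (a b : Fin N) → swap a b a ≡ b
swap-≡ˡ a b with a FP.≟ a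
... | yes _ = refl
... | no ne = ⊥-elim (ne refl)

swap-≡ʳ : ∀ {N} (a b : Fin N) → swap a b b ≡ a
swap-≡ʳ a b with b FP.≟ a
... | yes e = e
... | no _ with b FP.≟ b
... | yes _ = refl
... | no ne = ⊥-elim (ne refl)

swap-≢ : ∀ {N} {a b x : Fin N} → x ≢ a → x ≢ b → swap a b x ≡ x
swap-≢ {a = a} {b} {x} na nb with x FP.≟ a
... | yes e = ⊥-elim (na e)
... | no _ with x FP.≟ b
... | yes e = ⊥-elim (nb e)
... | no _ = refl

swap-involutive : ∀ {N} (a b x : Fin N) → swap a b (swap a b x) ≡ x
swap-involutive a b x with x FP.≟ a
... | yes e = trans (swap-≡ʳ a b) (sym e)
... | no na with x FP.≟ b
... | yes e = trans (swap-≡ˡ a b) (sym e)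
... | no nb = swap-≢ na nb

module AlternatingCycles {N : ℕ} (G : Graph N) (simp : IsSimple G) (M : PerfectMatching G)
          (T : Subset N) (forcing : IsForcingSet M T) where
  open IsSimple simp renaming (sym to gsym)
  p = partner M

  partner-injective : ∀ {x y} → p x ≡ p y → x ≡ y
  partner-injective {x} {y} e = trans (sym (invol M x)) (trans (cong p e) (invol M y))

  ≢partner-sym : ∀ {x y} → y ≢ p x → x ≢ p y
  ≢partner-sym {x} {y} ne e = ne (trans (sym (invol M y)) (cong p (sym e)))

  conjugateMatching : (π πi : Fin N → Fin N) → (∀ x → π (πi x) ≡ x) → (∀ x → πi (π x) ≡ x) →
           (∀ x → G x (π (p (πi x))) ≡ true) → PerfectMatching G
  conjugateMatching π πi e1 e2 ed = record
    { partner = λ x → π (p (πi x))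
    ; invol = λ x → trans (cong (λ z → π (p z)) (e2 (p (πi x)))) (trans (cong π (invol M (πi x))) (e1 x))
    ; nofix = λ x e → nofix M (πi x) (trans (sym (e2 (p (πi x)))) (cong πi e))
    ; edge = ed }

  Outside : Fin N → Set
  Outside x = lookup T x ≡ false

  covered≢outside : ∀ {x y} → lookup T x ≡ true → Outside y → x ≢ y
  covered≢outside tx oy refl = false≢true (trans (sym oy) tx)

  -- Conjugating M by a permutation π that fixes the covered vertices gives a matching agreeing
  -- with M on S; when it is a perfect matching of G, forcing makes it M itself.
  conjugate-forced : (π πi : Fin N → Fin N) (e1 : ∀ x → π (πi x) ≡ x) (e2 : ∀ x → πi (π x) ≡ x)
           (ed : ∀ x → G x (π (p (πi x))) ≡ true) →
           (∀ x → lookup T x ≡ true → π x ≡ x) → (∀ x → lookup T x ≡ true → πi x ≡ x) →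
           ∀ z → π (p (πi z)) ≡ p z
  conjugate-forced π πi e1 e2 ed fx fxi = proj₂ forcing (conjugateMatching π πi e1 e2 ed) agree
    where
    agree : ∀ u → u ∈ T → π (p (πi u)) ≡ p u
    agree u uT = trans (cong (λ w → π (p w)) (fxi u ([]=⇒lookup uT)))
                   (fx (p u) ([]=⇒lookup (proj₁ forcing u uT)))

  no-alternating-4-cycle : ∀ {a b} → Outside a → Outside b → b ≢ a → b ≢ p a → G a (p b) ≡ true → G b (p a) ≡ true → ⊥
  no-alternating-4-cycle {a} {b} oa ob ba bpa gab gba =
    ba (partner-injective (trans (sym e') (conjugate-forced (swap a b) (swap a b) (swap-involutive a b) (swap-involutive a b) ed fixes fixes a)))
    where
    fixes : ∀ x → lookup T x ≡ true → swap a b x ≡ x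
    fixes x tx = swap-≢ (covered≢outside tx oa) (covered≢outside tx ob)
    pb≢a : p b ≢ a
    pb≢a = λ e → ≢partner-sym bpa (sym e)
    e' : swap a b (p (swap a b a)) ≡ p b
    e' = trans (cong (λ w → swap a b (p w)) (swap-≡ˡ a b)) (swap-≢ pb≢a (nofix M b))
    ed : ∀ x → G x (swap a b (p (swap a b x))) ≡ true
    ed x = go (x FP.≟ a) (x FP.≟ b) (x FP.≟ p a) (x FP.≟ p b)
      where
      go : Dec (x ≡ a) → Dec (x ≡ b) → Dec (x ≡ p a) → Dec (x ≡ p b) → G x (swap a b (p (swap a b x))) ≡ true
      go (yes e) _ _ _ = subst (λ w → G w (swap a b (p (swap a b w))) ≡ true) (sym e) (trans (cong (G a) e') gab)
      go (no xa) (yes e) _ _ = subst (λ w → G w (swap a b (p (swap a b w))) ≡ true) (sym e)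
         (trans (cong (λ w → G b (swap a b (p w))) (swap-≡ʳ a b)) (trans (cong (G b) (swap-≢ (nofix M a) (λ e → bpa (sym e)))) gba))
      go (no xa) (no xb) (yes e) _ = subst (λ w → G w (swap a b (p (swap a b w))) ≡ true) (sym e)
         (trans (cong (λ w → G (p a) (swap a b (p w))) (swap-≢ (λ e′ → xa (trans e e′)) (λ e′ → xb (trans e e′))))
         (trans (cong (λ w → G (p a) (swap a b w)) (invol M a)) (trans (cong (G (p a)) (swap-≡ˡ a b)) (trans (gsym (p a) b) gba))))
      go (no xa) (no xb) (no _) (yes e) = subst (λ w → G w (swap a b (p (swap a b w))) ≡ true) (sym e)
         (trans (cong (λ w → G (p b) (swap a b (p w))) (swap-≢ (λ e′ → xa (trans e e′)) (λ e′ → xb (trans e e′))))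
         (trans (cong (λ w → G (p b) (swap a b w)) (invol M b)) (trans (cong (G (p b)) (swap-≡ʳ a b)) (trans (gsym (p b) a) gab))))
      go (no xa) (no xb) (no xpa) (no xpb) = trans (cong (λ w → G x (swap a b (p w))) (swap-≢ xa xb))
                     (trans (cong (G x) (swap-≢ (λ e → xpa (trans (sym (invol M x)) (cong p e))) (λ e → xpb (trans (sym (invol M x)) (cong p e))))) (edge M x))

  no-alternating-6-cycle : ∀ {a b c} → Outside a → Outside b → Outside c → b ≢ a → c ≢ a → c ≢ b → b ≢ p a → c ≢ p a → c ≢ p b →
       G a (p b) ≡ true → G b (p c) ≡ true → G c (p a) ≡ true → ⊥
  no-alternating-6-cycle {a} {b} {c} oa ob oc ba ca cb bpa cpa cpb gab gbc gca =
    ba (partner-injective (trans (sym (trans (cong (λ w → π (p w)) πia) (πo pb1 pb2 pb3))) (conjugate-forced π πi e1 e2 ed fx fxi a)))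
    where
    π πi : Fin N → Fin N
    π x = swap b c (swap a b x)
    πi x = swap a b (swap b c x)
    e1 : ∀ x → π (πi x) ≡ x
    e1 x = trans (cong (swap b c) (swap-involutive a b (swap b c x))) (swap-involutive b c x)
    e2 : ∀ x → πi (π x) ≡ x
    e2 x = trans (cong (swap a b) (swap-involutive b c (swap a b x))) (swap-involutive a b x)
    ab = λ e → ba (sym e)
    ac = λ e → ca (sym e)
    bc = λ e → cb (sym e)
    πia : πi a ≡ b
    πia = trans (cong (swap a b) (swap-≢ ab ac)) (swap-≡ˡ a b)
    πib : πi b ≡ c
    πib = trans (cong (swap a b) (swap-≡ˡ b c)) (swap-≢ ca cb)
    πic : πi c ≡ a
    πic = trans (cong (swap a b) (swap-≡ʳ b c)) (swap-≡ʳ a b)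
    πa : π a ≡ c
    πa = trans (cong (swap b c) (swap-≡ˡ a b)) (swap-≡ˡ b c)
    πb : π b ≡ a
    πb = trans (cong (swap b c) (swap-≡ʳ a b)) (swap-≢ ab ac)
    πc : π c ≡ b
    πc = trans (cong (swap b c) (swap-≢ ca cb)) (swap-≡ʳ b c)
    πo : ∀ {y} → y ≢ a → y ≢ b → y ≢ c → π y ≡ y
    πo ya yb yc = trans (cong (swap b c) (swap-≢ ya yb)) (swap-≢ yb yc)
    πio : ∀ {y} → y ≢ a → y ≢ b → y ≢ c → πi y ≡ y
    πio ya yb yc = trans (cong (swap a b) (swap-≢ yb yc)) (swap-≢ ya yb)
    pa1 : p a ≢ a
    pa1 = nofix M a
    pa2 : p a ≢ b
    pa2 = λ e → bpa (sym e)
    pa3 : p a ≢ c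
    pa3 = λ e → cpa (sym e)
    pb1 : p b ≢ a
    pb1 = λ e → ≢partner-sym bpa (sym e)
    pb2 : p b ≢ b
    pb2 = nofix M b
    pb3 : p b ≢ c
    pb3 = λ e → cpb (sym e)
    pc1 : p c ≢ a
    pc1 = λ e → ≢partner-sym cpa (sym e)
    pc2 : p c ≢ b
    pc2 = λ e → ≢partner-sym cpb (sym e)
    pc3 : p c ≢ c
    pc3 = nofix M c
    fx : ∀ x → lookup T x ≡ true → π x ≡ x
    fx x tx = πo (covered≢outside tx oa) (covered≢outside tx ob) (covered≢outside tx oc)
    fxi : ∀ x → lookup T x ≡ true → πi x ≡ x
    fxi x tx = πio (covered≢outside tx oa) (covered≢outside tx ob) (covered≢outside tx oc)
    ConjugateEdgeAt : Fin N → Set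
    ConjugateEdgeAt w = G w (π (p (πi w))) ≡ true
    ed : ∀ x → ConjugateEdgeAt x
    ed x = go (x FP.≟ a) (x FP.≟ b) (x FP.≟ c) (x FP.≟ p a) (x FP.≟ p b) (x FP.≟ p c)
      where
      go : Dec (x ≡ a) → Dec (x ≡ b) → Dec (x ≡ c) → Dec (x ≡ p a) → Dec (x ≡ p b) → Dec (x ≡ p c) → ConjugateEdgeAt x
      go (yes e) _ _ _ _ _ = subst ConjugateEdgeAt (sym e) (trans (cong (λ w → G a (π (p w))) πia) (trans (cong (G a) (πo pb1 pb2 pb3)) gab))
      go _ (yes e) _ _ _ _ = subst ConjugateEdgeAt (sym e) (trans (cong (λ w → G b (π (p w))) πib) (trans (cong (G b) (πo pc1 pc2 pc3)) gbc))
      go _ _ (yes e) _ _ _ = subst ConjugateEdgeAt (sym e) (trans (cong (λ w → G c (π (p w))) πic) (trans (cong (G c) (πo pa1 pa2 pa3)) gca))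
      go _ _ _ (yes e) _ _ = subst ConjugateEdgeAt (sym e) (trans (cong (λ w → G (p a) (π (p w))) (πio pa1 pa2 pa3))
                                 (trans (cong (λ w → G (p a) (π w)) (invol M a)) (trans (cong (G (p a)) πa) (trans (gsym (p a) c) gca))))
      go _ _ _ _ (yes e) _ = subst ConjugateEdgeAt (sym e) (trans (cong (λ w → G (p b) (π (p w))) (πio pb1 pb2 pb3))
                                 (trans (cong (λ w → G (p b) (π w)) (invol M b)) (trans (cong (G (p b)) πb) (trans (gsym (p b) a) gab))))
      go _ _ _ _ _ (yes e) = subst ConjugateEdgeAt (sym e) (trans (cong (λ w → G (p c) (π (p w))) (πio pc1 pc2 pc3))
                                 (trans (cong (λ w → G (p c) (π w)) (invol M c)) (trans (cong (G (p c)) πc) (trans (gsym (p c) b) gbc))))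
      go (no xa) (no xb) (no xc) (no xpa) (no xpb) (no xpc) =
        trans (cong (λ w → G x (π (p w))) (πio xa xb xc))
          (trans (cong (G x) (πo (q xpa) (q xpb) (q xpc))) (edge M x))
        where
        q : ∀ {y} → x ≢ p y → p x ≢ y
        q {y} ne e = ne (trans (sym (invol M x)) (cong p e))


-- Counting ordered pairs of vertices

⟦_⟧ : Bool → ℕ
⟦_⟧ = boolToℕ

same : ∀ {N} → Fin N → Fin N → Bool
same x y = toℕ x ≡ᵇ toℕ y

same-refl : ∀ {N} (x : Fin N) → same x x ≡ true
same-refl x with toℕ x ≡ᵇ toℕ x | ≡⇒≡ᵇ (toℕ x) (toℕ x) refl
... | true | _ = refl

same⇒≡ : ∀ {N} {x y : Fin N} → same x y ≡ true → x ≡ y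
same⇒≡ {x = x} {y} e = FP.toℕ-injective (≡ᵇ⇒≡ (toℕ x) (toℕ y) (subst T (sym e) _))

≢⇒same-false : ∀ {N} {x y : Fin N} → x ≢ y → same x y ≡ false
≢⇒same-false {x = x} {y} ne with same x y in e
... | true = ⊥-elim (ne (same⇒≡ e))
... | false = refl


⟦⟧≤1 : ∀ b → ⟦ b ⟧ ≤ 1
⟦⟧≤1 true = s≤s z≤n
⟦⟧≤1 false = z≤n

∑-point : ∀ {N} (f : Fin N → ℕ) (x : Fin N) → ∑ (λ y → ⟦ same y x ⟧ * f y) ≡ f x
∑-point {suc N} f zero = trans (cong₂ _+_ (+-identityʳ (f zero)) (∑-0 {N})) (+-identityʳ (f zero))
∑-point {suc N} f (suc x) = ∑-point (λ y → f (suc y)) x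

∑∑ : ∀ {N} → (Fin N → Fin N → ℕ) → ℕ
∑∑ f = ∑ λ x → ∑ λ y → f x y

∑∑-cong : ∀ {N} {f g : Fin N → Fin N → ℕ} → (∀ x y → f x y ≡ g x y) → ∑∑ f ≡ ∑∑ g
∑∑-cong e = ∑-cong (λ x → ∑-cong (e x))

∑∑-+ : ∀ {N} (f g : Fin N → Fin N → ℕ) → ∑∑ (λ x y → f x y + g x y) ≡ ∑∑ f + ∑∑ g
∑∑-+ {N} f g = trans (∑-cong (λ x → ∑-+ (f x) (g x))) (∑-+ {N} (λ x → ∑ (f x)) (λ x → ∑ (g x)))

∑∑-zero : ∀ {N} (f : Fin N → Fin N → ℕ) → ∑∑ f ≡ 0 → ∀ x y → f x y ≡ 0
∑∑-zero f e x y = ∑≡0⇒≡0 (f x) (∑≡0⇒≡0 (λ x → ∑ (f x)) e x) y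

∑∑-+-∸ : ∀ {N} (f g : Fin N → Fin N → ℕ) → (∀ x y → f x y ≤ g x y) → ∑∑ f + ∑∑ (λ x y → g x y ∸ f x y) ≡ ∑∑ g
∑∑-+-∸ f g le = trans (sym (∑∑-+ f (λ x y → g x y ∸ f x y))) (∑∑-cong (λ x y → m+[n∸m]≡n (le x y)))

∧-true : ∀ {a b} → (a ∧ b) ≡ true → a ≡ true × b ≡ true
∧-true {true} {true} _ = refl , refl

not-true : ∀ {a} → not a ≡ true → a ≡ false
not-true {false} _ = refl

⟦∧⟧-flip : ∀ a b → ⟦ a ∧ b ⟧ ≡ ⟦ b ⟧ * ⟦ a ⟧
⟦∧⟧-flip true true = refl
⟦∧⟧-flip true false = refl
⟦∧⟧-flip false true = refl
⟦∧⟧-flip false false = refl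

⟦∧⟧ : ∀ a b → ⟦ a ∧ b ⟧ ≡ ⟦ a ⟧ * ⟦ b ⟧
⟦∧⟧ true true = refl
⟦∧⟧ true false = refl
⟦∧⟧ false true = refl
⟦∧⟧ false false = refl

⟦⟧-split : ∀ a g → ⟦ g ⟧ ≡ ⟦ a ∧ g ⟧ + ⟦ not a ∧ g ⟧
⟦⟧-split true g = sym (+-identityʳ _)
⟦⟧-split false g = refl

⟦⟧-partition : ∀ a e → ⟦ a ∧ not e ⟧ + ⟦ not a ∧ not e ⟧ + ⟦ e ⟧ ≡ 1
⟦⟧-partition true true = refl
⟦⟧-partition true false = refl
⟦⟧-partition false true = refl
⟦⟧-partition false false = refl

⟦∧⟧-split : ∀ a e → ⟦ a ∧ not e ⟧ + ⟦ a ∧ e ⟧ ≡ ⟦ a ⟧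
⟦∧⟧-split true true = refl
⟦∧⟧-split true false = refl
⟦∧⟧-split false e = refl

crossEdge≤-table : ∀ a g e → (e ≡ true → g ≡ false) → ⟦ not a ∧ g ⟧ ≤ ⟦ not a ∧ not e ⟧
crossEdge≤-table true g e h = z≤n
crossEdge≤-table false g true h rewrite h refl = z≤n
crossEdge≤-table false g false h = ⟦⟧≤1 g

innerEdges≤-table : ∀ a g1 g2 e1 e2 → (a ≡ true → e1 ≡ true → g1 ≡ false) → (a ≡ true → e1 ≡ true → g2 ≡ false) →
        (a ≡ true → e1 ≡ false → e2 ≡ false → g1 ≡ true → g2 ≡ true → ⊥) →
        ⟦ a ∧ g1 ⟧ + ⟦ a ∧ g2 ⟧ ≤ ⟦ a ∧ not e1 ⟧ + ⟦ a ∧ e2 ⟧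
innerEdges≤-table false _ _ _ _ _ _ _ = z≤n
innerEdges≤-table true g1 g2 true e2 h1 h2 h3 rewrite h1 refl refl | h2 refl refl = z≤n
innerEdges≤-table true g1 g2 false true h1 h2 h3 = +-mono-≤ (⟦⟧≤1 g1) (⟦⟧≤1 g2)
innerEdges≤-table true true true false false h1 h2 h3 = ⊥-elim (h3 refl refl refl refl refl)
innerEdges≤-table true true false false false h1 h2 h3 = ≤-refl
innerEdges≤-table true false g2 false false h1 h2 h3 = ⟦⟧≤1 g2

≤ᵇ-true : ∀ {m n} → m ≤ n → (m ≤ᵇ n) ≡ true
≤ᵇ-true {m} {n} le with m ≤ᵇ n | ≤⇒≤ᵇ le
... | true | _ = refl

≤ᵇ-false : ∀ {m n} → ¬ (m ≤ n) → (m ≤ᵇ n) ≡ false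
≤ᵇ-false {m} {n} nle with m ≤ᵇ n in e
... | false = refl
... | true = ⊥-elim (nle (≤ᵇ⇒≤ m n (subst T (sym e) _)))

<ᵇ-trichotomy : ∀ a b → a ≢ b → ⟦ suc a ≤ᵇ b ⟧ + ⟦ suc b ≤ᵇ a ⟧ ≡ 1
<ᵇ-trichotomy a b ne with <-cmp a b
... | tri< lt _ _ = cong₂ (λ u v → ⟦ u ⟧ + ⟦ v ⟧) (≤ᵇ-true lt) (≤ᵇ-false (<⇒≯ lt))
... | tri≈ _ e _ = ⊥-elim (ne e)
... | tri> _ _ gt = cong₂ (λ u v → ⟦ u ⟧ + ⟦ v ⟧) (≤ᵇ-false (<⇒≯ gt)) (≤ᵇ-true gt)

handshake : ∀ {N} (G : Graph N) → IsSimple G → ∑∑ (λ x y → ⟦ G x y ⟧) ≡ edgeCount G + edgeCount G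
handshake {N} G simp = trans (∑∑-cong pw) (trans (∑∑-+ {N} (λ x y → ⟦ (suc (toℕ x) ≤ᵇ toℕ y) ∧ G x y ⟧) (λ x y → ⟦ (suc (toℕ y) ≤ᵇ toℕ x) ∧ G y x ⟧)) (cong (edgeCount G +_) (∑-swap (λ x y → ⟦ (suc (toℕ y) ≤ᵇ toℕ x) ∧ G y x ⟧))))
  where
  open IsSimple simp renaming (sym to gsym)
  pw : ∀ x y → ⟦ G x y ⟧ ≡ ⟦ (suc (toℕ x) ≤ᵇ toℕ y) ∧ G x y ⟧ + ⟦ (suc (toℕ y) ≤ᵇ toℕ x) ∧ G y x ⟧
  pw x y with x FP.≟ y
  ... | yes refl rewrite irrefl x | ≤ᵇ-false (n≮n (toℕ x)) = refl
  ... | no ne rewrite gsym y x | ⟦∧⟧-flip (suc (toℕ x) ≤ᵇ toℕ y) (G x y) | ⟦∧⟧-flip (suc (toℕ y) ≤ᵇ toℕ x) (G x y)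
        = sym (trans (sym (*-distribˡ-+ ⟦ G x y ⟧ _ _)) (trans (cong (⟦ G x y ⟧ *_) (<ᵇ-trichotomy (toℕ x) (toℕ y) (λ e → ne (FP.toℕ-injective e)))) (*-identityʳ _)))

module Count {N : ℕ} (G : Graph N) (simp : IsSimple G) (M : PerfectMatching G)
          (T : Subset N) (forcing : IsForcingSet M T) where
  open AlternatingCycles G simp M T forcing public
  open IsSimple simp renaming (sym to gsym)

  inT : Fin N → Bool
  inT x = lookup T x
  o : Fin N → Bool
  o x = not (inT x)

  inT-partner : ∀ x → inT (p x) ≡ inT x
  inT-partner x with lookup T x in e
  ... | true = []=⇒lookup (proj₁ forcing x (lookup⇒[]= x T e))
  ... | false with lookup T (p x) in e2
  ... | false = refl
  ... | true = trans (sym (subst (λ w → lookup T w ≡ true) (invol M x) ([]=⇒lookup (proj₁ forcing (p x) (lookup⇒[]= (p x) T e2))))) e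

  out-partner : ∀ x → o (p x) ≡ o x
  out-partner x = cong not (inT-partner x)

  out⇒Outside : ∀ {x} → o x ≡ true → Outside x
  out⇒Outside e = not-true e

  partner↔ : Fin N ↔ Fin N
  partner↔ = mk↔ₛ′ p p (invol M) (invol M)

  ∑-partner : (f : Fin N → ℕ) → ∑ (λ x → f (p x)) ≡ ∑ f
  ∑-partner f = ∑-permute partner↔ f

  ∑∑-partner : (f : Fin N → Fin N → ℕ) → ∑∑ (λ x y → f (p x) (p y)) ≡ ∑∑ f
  ∑∑-partner f = trans (∑-partner (λ x → ∑ (λ y → f x (p y)))) (∑-cong (λ x → ∑-partner (f x)))

  bothOut : Fin N → Fin N → Bool
  bothOut x y = o x ∧ o y

  nO : ℕ
  nO = ∑ (λ x → ⟦ o x ⟧)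
  nT : ℕ
  nT = ∑ (λ x → ⟦ inT x ⟧)

  -- Weights of an ordered pair (x , y).  Off O × O: crossEdge ≤ crossPair = [y ≢ x].  On O × O:
  -- innerEdges = [xy ∈ G] + [MxMy ∈ G] ≤ innerSlots, which is 0, 1, 2 for y = x, y ∉ {x , Mx}, y = Mx.
  crossEdge crossPair innerPair innerEdges innerSlots : Fin N → Fin N → ℕ
  crossEdge x y = ⟦ not (bothOut x y) ∧ G x y ⟧
  crossPair x y = ⟦ not (bothOut x y) ∧ not (same y x) ⟧
  innerPair x y = ⟦ bothOut x y ∧ not (same y x) ⟧
  innerEdges x y = ⟦ bothOut x y ∧ G x y ⟧ + ⟦ bothOut x y ∧ G (p x) (p y) ⟧
  innerSlots x y = innerPair x y + ⟦ bothOut x y ∧ same y (p x) ⟧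

  crossEdge≤crossPair : ∀ x y → crossEdge x y ≤ crossPair x y
  crossEdge≤crossPair x y = crossEdge≤-table (bothOut x y) (G x y) (same y x) (λ e → subst (λ w → G x w ≡ false) (sym (same⇒≡ e)) (irrefl x))

  innerEdges≤innerSlots : ∀ x y → innerEdges x y ≤ innerSlots x y
  innerEdges≤innerSlots x y = innerEdges≤-table (bothOut x y) (G x y) (G (p x) (p y)) (same y x) (same y (p x))
    (λ _ e → subst (λ w → G x w ≡ false) (sym (same⇒≡ e)) (irrefl x))
    (λ _ e → subst (λ w → G (p x) (p w) ≡ false) (sym (same⇒≡ e)) (irrefl (p x)))
    h3
    where
    h3 : bothOut x y ≡ true → same y x ≡ false → same y (p x) ≡ false → G x y ≡ true → G (p x) (p y) ≡ true → ⊥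
    h3 a e1 e2 g1 g2 = no-alternating-4-cycle {x} {p y} (out⇒Outside (proj₁ (∧-true a))) (out⇒Outside (trans (out-partner y) (proj₂ (∧-true a))))
      (λ e → ≢partner-sym (λ e' → ne2 e') (sym e)) (λ e → ne1 (partner-injective e))
      (trans (cong (G x) (invol M y)) g1) (trans (gsym (p y) (p x)) g2)
      where
      ne1 : y ≢ x
      ne1 e = false≢true (trans (sym e1) (subst (λ w → same w x ≡ true) (sym e) (same-refl x)))
      ne2 : y ≢ p x
      ne2 e = false≢true (trans (sym e2) (subst (λ w → same w (p x) ≡ true) (sym e) (same-refl (p x))))

  degSum innerDegSum crossDegSum crossGap crossPairCount innerEdgeCount innerGap innerSlotCount innerPairCount : ℕ
  degSum = ∑∑ (λ x y → ⟦ G x y ⟧)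
  innerDegSum = ∑∑ (λ x y → ⟦ bothOut x y ∧ G x y ⟧)
  crossDegSum = ∑∑ crossEdge
  crossGap = ∑∑ (λ x y → crossPair x y ∸ crossEdge x y)
  crossPairCount = ∑∑ crossPair
  innerEdgeCount = ∑∑ innerEdges
  innerGap = ∑∑ (λ x y → innerSlots x y ∸ innerEdges x y)
  innerSlotCount = ∑∑ innerSlots
  innerPairCount = ∑∑ innerPair

  degSum-split : degSum ≡ innerDegSum + crossDegSum
  degSum-split = trans (∑∑-cong (λ x y → ⟦⟧-split (bothOut x y) (G x y))) (∑∑-+ {N} (λ x y → ⟦ bothOut x y ∧ G x y ⟧) crossEdge)

  crossGap-sum : crossDegSum + crossGap ≡ crossPairCount
  crossGap-sum = ∑∑-+-∸ crossEdge crossPair crossEdge≤crossPair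

  innerGap-sum : innerEdgeCount + innerGap ≡ innerSlotCount
  innerGap-sum = ∑∑-+-∸ innerEdges innerSlots innerEdges≤innerSlots

  innerEdgeCount≡ : innerEdgeCount ≡ innerDegSum + innerDegSum
  innerEdgeCount≡ = trans (∑∑-+ (λ x y → ⟦ bothOut x y ∧ G x y ⟧) (λ x y → ⟦ bothOut x y ∧ G (p x) (p y) ⟧))
        (cong (innerDegSum +_) (trans (∑∑-cong (λ x y → cong (λ b → ⟦ b ∧ G (p x) (p y) ⟧) (sym (cong₂ _∧_ (out-partner x) (out-partner y)))))
           (∑∑-partner (λ x y → ⟦ bothOut x y ∧ G x y ⟧))))

  ∑-bothOut : ∀ x → ∑ (λ y → ⟦ bothOut x y ⟧) ≡ ⟦ o x ⟧ * nO
  ∑-bothOut x = trans (∑-cong (λ y → ⟦∧⟧ (o x) (o y))) (∑-*ˡ ⟦ o x ⟧ (λ y → ⟦ o y ⟧))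

  ∑-bothOut-same : ∀ x z → ∑ (λ y → ⟦ bothOut x y ∧ same y z ⟧) ≡ ⟦ bothOut x z ⟧
  ∑-bothOut-same x z = trans (∑-cong (λ y → ⟦∧⟧-flip (bothOut x y) (same y z))) (∑-point (λ y → ⟦ bothOut x y ⟧) z)

  ∑-innerPair : ∀ x → ∑ (innerPair x) + ⟦ bothOut x x ⟧ ≡ ⟦ o x ⟧ * nO
  ∑-innerPair x = trans (cong (∑ (innerPair x) +_) (sym (∑-bothOut-same x x)))
          (trans (sym (∑-+ (innerPair x) (λ y → ⟦ bothOut x y ∧ same y x ⟧)))
           (trans (∑-cong (λ y → ⟦∧⟧-split (bothOut x y) (same y x))) (∑-bothOut x)))

  bothOut-diag : ∀ x → ⟦ bothOut x x ⟧ ≡ ⟦ o x ⟧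
  bothOut-diag x = cong ⟦_⟧ (∧-idem (o x))

  ∑-innerSlots : ∀ x → ∑ (innerSlots x) ≡ ⟦ o x ⟧ * nO
  ∑-innerSlots x = trans (∑-+ (innerPair x) (λ y → ⟦ bothOut x y ∧ same y (p x) ⟧))
            (trans (cong (∑ (innerPair x) +_) (trans (∑-bothOut-same x (p x)) (cong (λ b → ⟦ o x ∧ b ⟧) (out-partner x)))) (∑-innerPair x))

  ∑-out*nO : ∑ (λ x → ⟦ o x ⟧ * nO) ≡ nO * nO
  ∑-out*nO = trans (∑-cong (λ x → *-comm ⟦ o x ⟧ nO)) (∑-*ˡ nO (λ x → ⟦ o x ⟧))

  innerSlotCount≡ : innerSlotCount ≡ nO * nO
  innerSlotCount≡ = trans (∑-cong ∑-innerSlots) ∑-out*nO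

  innerPairCount≡ : innerPairCount + nO ≡ nO * nO
  innerPairCount≡ = trans (cong (innerPairCount +_) (sym (∑-cong bothOut-diag))) (trans (sym (∑-+ (λ x → ∑ (innerPair x)) (λ x → ⟦ bothOut x x ⟧))) (trans (∑-cong ∑-innerPair) ∑-out*nO))

  ∑∑-same : ∑∑ {N} (λ x y → ⟦ same y x ⟧) ≡ N
  ∑∑-same = trans (∑-cong {N} {f = λ x → ∑ (λ y → ⟦ same y x ⟧)} {g = λ _ → 1} (λ x → trans (∑-cong {N} {g = λ y → ⟦ same y x ⟧ * 1} (λ y → sym (*-identityʳ _))) (∑-point {N} (λ _ → 1) x))) (∑-1 {N})
  ∑∑-1 : ∑∑ {N} (λ _ _ → 1) ≡ N * N
  ∑∑-1 = trans (∑-cong {N} {f = λ x → ∑ {N} (λ _ → 1)} {g = λ _ → N} (λ x → ∑-1 {N})) (trans (∑-cong {N} {g = λ _ → N * 1} (λ x → sym (*-identityʳ N))) (trans (∑-*ˡ {N} N (λ _ → 1)) (cong (N *_) (∑-1 {N}))))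

  pairCount≡ : innerPairCount + crossPairCount + N ≡ N * N
  pairCount≡ = trans (cong (λ z → innerPairCount + crossPairCount + z) (sym ∑∑-same))
        (trans (cong (_+ ∑∑ {N} (λ x y → ⟦ same y x ⟧)) (sym (∑∑-+ innerPair crossPair)))
         (trans (sym (∑∑-+ {N} (λ x y → innerPair x y + crossPair x y) (λ x y → ⟦ same y x ⟧)))
          (trans (∑∑-cong {g = λ _ _ → 1} (λ x y → ⟦⟧-partition (bothOut x y) (same y x))) ∑∑-1)))

  counting-identity : 2 * degSum + (2 * crossGap + innerGap) + nO * nO + 2 * N ≡ 2 * (N * N) + 2 * nO
  counting-identity = begin
    2 * degSum + (2 * crossGap + innerGap) + nO * nO + 2 * N
      ≡⟨ cong (λ z → 2 * z + (2 * crossGap + innerGap) + nO * nO + 2 * N) degSum-split ⟩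
    2 * (innerDegSum + crossDegSum) + (2 * crossGap + innerGap) + nO * nO + 2 * N
      ≡⟨ regroup-degSum innerDegSum crossDegSum crossGap innerGap (nO * nO) N ⟩
    (innerDegSum + innerDegSum + innerGap) + nO * nO + 2 * (crossDegSum + crossGap) + 2 * N
      ≡⟨ cong (λ z → z + nO * nO + 2 * (crossDegSum + crossGap) + 2 * N) (trans (cong (_+ innerGap) (sym innerEdgeCount≡)) (trans innerGap-sum innerSlotCount≡)) ⟩
    nO * nO + nO * nO + 2 * (crossDegSum + crossGap) + 2 * N
      ≡⟨ cong (λ z → z + 2 * (crossDegSum + crossGap) + 2 * N) (trans (cong (nO * nO +_) (sym (+-identityʳ (nO * nO)))) (cong (2 *_) (sym innerPairCount≡))) ⟩
    2 * (innerPairCount + nO) + 2 * (crossDegSum + crossGap) + 2 * N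
      ≡⟨ sym (regroup-pairs innerPairCount crossDegSum crossGap N nO) ⟩
    2 * (innerPairCount + (crossDegSum + crossGap) + N) + 2 * nO
      ≡⟨ cong (λ z → 2 * (innerPairCount + z + N) + 2 * nO) crossGap-sum ⟩
    2 * (innerPairCount + crossPairCount + N) + 2 * nO
      ≡⟨ cong (λ z → 2 * z + 2 * nO) pairCount≡ ⟩
    2 * (N * N) + 2 * nO ∎
    where
    open ≡-Reasoning
    regroup-degSum : ∀ d r g2 g1 a nn → 2 * (d + r) + (2 * g2 + g1) + a + 2 * nn ≡ (d + d + g1) + a + 2 * (r + g2) + 2 * nn
    regroup-degSum = solve-∀
    regroup-pairs : ∀ s1 r g2 n nO → 2 * (s1 + (r + g2) + n) + 2 * nO ≡ 2 * (s1 + nO) + 2 * (r + g2) + 2 * n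
    regroup-pairs = solve-∀

  nO+nT≡N : nO + nT ≡ N
  nO+nT≡N = trans (sym (∑-+ (λ x → ⟦ o x ⟧) (λ x → ⟦ inT x ⟧))) (trans (∑-cong (λ x → c (inT x))) (∑-1 {N}))
    where c : ∀ b → ⟦ not b ⟧ + ⟦ b ⟧ ≡ 1
          c true = refl
          c false = refl

  nT≡2∣S∣ : nT ≡ edgesOf M T + edgesOf M T
  nT≡2∣S∣ = trans (∑-cong pw) (trans (∑-+ {N} (λ u → ⟦ inT u ∧ (suc (toℕ u) ≤ᵇ toℕ (p u)) ⟧) (λ u → ⟦ inT u ∧ (suc (toℕ (p u)) ≤ᵇ toℕ u) ⟧)) (cong (edgesOf M T +_) (trans (∑-cong (λ u → sym (e2 u))) (∑-partner (λ u → ⟦ inT u ∧ (suc (toℕ u) ≤ᵇ toℕ (p u)) ⟧)))))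
    where
    e2 : ∀ u → ⟦ inT (p u) ∧ (suc (toℕ (p u)) ≤ᵇ toℕ (p (p u))) ⟧ ≡ ⟦ inT u ∧ (suc (toℕ (p u)) ≤ᵇ toℕ u) ⟧
    e2 u = cong₂ (λ a b → ⟦ a ∧ (suc (toℕ (p u)) ≤ᵇ toℕ b) ⟧) (inT-partner u) (invol M u)
    pw : ∀ u → ⟦ inT u ⟧ ≡ ⟦ inT u ∧ (suc (toℕ u) ≤ᵇ toℕ (p u)) ⟧ + ⟦ inT u ∧ (suc (toℕ (p u)) ≤ᵇ toℕ u) ⟧
    pw u rewrite ⟦∧⟧ (inT u) (suc (toℕ u) ≤ᵇ toℕ (p u)) | ⟦∧⟧ (inT u) (suc (toℕ (p u)) ≤ᵇ toℕ u)
      = sym (trans (sym (*-distribˡ-+ ⟦ inT u ⟧ _ _)) (trans (cong (⟦ inT u ⟧ *_) (<ᵇ-trichotomy (toℕ u) (toℕ (p u)) (λ e → nofix M u (sym (FP.toℕ-injective e))))) (*-identityʳ _)))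


module Bound {n : ℕ} (G : Graph (2 * n)) (simp : IsSimple G) (M : PerfectMatching G)
          (T : Subset (2 * n)) (forcing : IsForcingSet M T) where
  open Count G simp M T forcing public

  t : ℕ
  t = edgesOf M T
  e : ℕ
  e = edgeCount G
  gaps : ℕ
  gaps = 2 * crossGap + innerGap

  counting-identity-2n : 4 * e + gaps + nO * nO + 4 * n ≡ 8 * (n * n) + 2 * nO
  counting-identity-2n = begin
    4 * e + gaps + nO * nO + 4 * n                ≡⟨ cong₂ (λ a b → a + gaps + nO * nO + b) 4e≡2degSum (quadruple≡2*2* n) ⟩
    2 * degSum + gaps + nO * nO + 2 * (2 * n)     ≡⟨ counting-identity ⟩
    2 * (2 * n * (2 * n)) + 2 * nO                ≡⟨ cong (_+ 2 * nO) (2*square-double≡8*square n) ⟩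
    8 * (n * n) + 2 * nO                          ∎
    where
    open ≡-Reasoning
    quadruple≡2*double : ∀ x → 4 * x ≡ 2 * (x + x)
    quadruple≡2*double = solve-∀
    quadruple≡2*2* : ∀ x → 4 * x ≡ 2 * (2 * x)
    quadruple≡2*2* = solve-∀
    4e≡2degSum : 4 * e ≡ 2 * degSum
    4e≡2degSum = trans (quadruple≡2*double e) (cong (2 *_) (sym (handshake G simp)))
    2*square-double≡8*square : ∀ x → 2 * (2 * x * (2 * x)) ≡ 8 * (x * x)
    2*square-double≡8*square = solve-∀

  nO≡2[n∸t] : ∀ m → n ≡ t + suc m → nO ≡ 2 * suc m
  nO≡2[n∸t] m n≡t+1+m = +-cancelʳ-≡ (t + t) nO (2 * suc m)
    (trans (trans (cong (nO +_) (sym nT≡2∣S∣)) nO+nT≡N) (trans (cong (2 *_) n≡t+1+m) (regroup t m)))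
    where
    regroup : ∀ x y → 2 * (x + suc y) ≡ 2 * suc y + (x + x)
    regroup = solve-∀

  -- Writing n = t + 1 + m, so that nO = 2 (m + 1), adding 4 m + 3 + 4 n to both sides turns them
  -- into the two sides of counting-identity-2n.
  bound-identity : t < n → (2 * n ∸ (1 + 2 * t)) ^ 2 + 4 * e + gaps ≡ 4 * n * (2 * n ∸ 1) + 1
  bound-identity t<n with m≤n⇒∃[o]m+o≡n t<n
  ... | m , 1+t+m≡n = +-cancelʳ-≡ (4 * m + 3 + 4 * n) _ _ (trans lhs≡ (sym rhs≡))
    where
    open ≡-Reasoning
    split-2n : ∀ x y → 2 * (x + suc y) ≡ (1 + 2 * x) + (2 * y + 1)
    split-2n = solve-∀
    pred-2n : ∀ x y → 2 * (x + suc y) ≡ suc (2 * (x + y) + 1)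
    pred-2n = solve-∀
    expand-lhs : ∀ x y g z → (2 * x + 1) * ((2 * x + 1) * 1) + 4 * y + g + (4 * x + 3 + 4 * z) ≡ 4 * y + g + (2 * suc x) * (2 * suc x) + 4 * z
    expand-lhs = solve-∀
    expand-rhs : ∀ x y → 4 * (x + suc y) * (2 * (x + y) + 1) + 1 + (4 * y + 3 + 4 * (x + suc y)) ≡ 8 * ((x + suc y) * (x + suc y)) + 2 * (2 * suc y)
    expand-rhs = solve-∀
    n≡t+1+m : n ≡ t + suc m
    n≡t+1+m = trans (sym 1+t+m≡n) (sym (+-suc t m))
    nO≡ = nO≡2[n∸t] m n≡t+1+m
    2n∸[1+2t]≡2m+1 : 2 * n ∸ (1 + 2 * t) ≡ 2 * m + 1
    2n∸[1+2t]≡2m+1 = trans (cong (λ z → 2 * z ∸ (1 + 2 * t)) n≡t+1+m)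
      (trans (cong (_∸ (1 + 2 * t)) (split-2n t m)) (m+n∸m≡n (1 + 2 * t) (2 * m + 1)))
    2n∸1≡2[t+m]+1 : 2 * n ∸ 1 ≡ 2 * (t + m) + 1
    2n∸1≡2[t+m]+1 = trans (cong (λ z → 2 * z ∸ 1) n≡t+1+m) (cong (_∸ 1) (pred-2n t m))
    lhs≡ : (2 * n ∸ (1 + 2 * t)) ^ 2 + 4 * e + gaps + (4 * m + 3 + 4 * n) ≡ 8 * (n * n) + 2 * nO
    lhs≡ = begin
      (2 * n ∸ (1 + 2 * t)) ^ 2 + 4 * e + gaps + (4 * m + 3 + 4 * n)
        ≡⟨ cong (λ z → z ^ 2 + 4 * e + gaps + (4 * m + 3 + 4 * n)) 2n∸[1+2t]≡2m+1 ⟩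
      (2 * m + 1) ^ 2 + 4 * e + gaps + (4 * m + 3 + 4 * n)
        ≡⟨ expand-lhs m e gaps n ⟩
      4 * e + gaps + (2 * suc m) * (2 * suc m) + 4 * n
        ≡⟨ cong (λ z → 4 * e + gaps + z * z + 4 * n) (sym nO≡) ⟩
      4 * e + gaps + nO * nO + 4 * n
        ≡⟨ counting-identity-2n ⟩
      8 * (n * n) + 2 * nO ∎
    rhs≡ : 4 * n * (2 * n ∸ 1) + 1 + (4 * m + 3 + 4 * n) ≡ 8 * (n * n) + 2 * nO
    rhs≡ = begin
      4 * n * (2 * n ∸ 1) + 1 + (4 * m + 3 + 4 * n)
        ≡⟨ cong (λ z → 4 * n * z + 1 + (4 * m + 3 + 4 * n)) 2n∸1≡2[t+m]+1 ⟩
      4 * n * (2 * (t + m) + 1) + 1 + (4 * m + 3 + 4 * n)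
        ≡⟨ cong (λ z → 4 * z * (2 * (t + m) + 1) + 1 + (4 * m + 3 + 4 * z)) n≡t+1+m ⟩
      4 * (t + suc m) * (2 * (t + m) + 1) + 1 + (4 * m + 3 + 4 * (t + suc m))
        ≡⟨ expand-rhs t m ⟩
      8 * ((t + suc m) * (t + suc m)) + 2 * (2 * suc m)
        ≡⟨ cong₂ (λ a b → 8 * (a * a) + 2 * b) (sym n≡t+1+m) (sym nO≡) ⟩
      8 * (n * n) + 2 * nO ∎

-- Equality in the bound

crossEdge≡⇒edge-table : ∀ a g e → a ≡ false → e ≡ false → ⟦ not a ∧ g ⟧ ≡ ⟦ not a ∧ not e ⟧ → g ≡ true
crossEdge≡⇒edge-table false true false refl refl _ = refl
crossEdge≡⇒edge-table false false false refl refl ()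

innerEdges≡⇒one-table : ∀ a g1 g2 e1 e2 → a ≡ true → e1 ≡ false → e2 ≡ false →
      ⟦ a ∧ g1 ⟧ + ⟦ a ∧ g2 ⟧ ≡ ⟦ a ∧ not e1 ⟧ + ⟦ a ∧ e2 ⟧ → ⟦ g1 ⟧ + ⟦ g2 ⟧ ≡ 1
innerEdges≡⇒one-table true g1 g2 false false refl refl refl h = h

crossEdge≡-table : ∀ a g e → (a ≡ false → e ≡ false → g ≡ true) → (e ≡ true → g ≡ false) → ⟦ not a ∧ g ⟧ ≡ ⟦ not a ∧ not e ⟧
crossEdge≡-table true g e h1 h2 = refl
crossEdge≡-table false g true h1 h2 rewrite h2 refl = refl
crossEdge≡-table false g false h1 h2 rewrite h1 refl refl = refl

innerEdges≡-table : ∀ a g1 g2 e1 e2 → (a ≡ true → e1 ≡ true → g1 ≡ false) → (a ≡ true → e1 ≡ true → g2 ≡ false) →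
     (a ≡ true → e1 ≡ true → e2 ≡ false) → (a ≡ true → e1 ≡ false → e2 ≡ true → g1 ≡ true × g2 ≡ true) →
     (a ≡ true → e1 ≡ false → e2 ≡ false → ⟦ g1 ⟧ + ⟦ g2 ⟧ ≡ 1) →
     ⟦ a ∧ g1 ⟧ + ⟦ a ∧ g2 ⟧ ≡ ⟦ a ∧ not e1 ⟧ + ⟦ a ∧ e2 ⟧
innerEdges≡-table false g1 g2 e1 e2 h1 h2 h3 h4 h5 = refl
innerEdges≡-table true g1 g2 true e2 h1 h2 h3 h4 h5 rewrite h1 refl refl | h2 refl refl | h3 refl refl = refl
innerEdges≡-table true g1 g2 false true h1 h2 h3 h4 h5 rewrite proj₁ (h4 refl refl refl) | proj₂ (h4 refl refl refl) = refl
innerEdges≡-table true g1 g2 false false h1 h2 h3 h4 h5 = h5 refl refl refl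

same-false⇒≢ : ∀ {N} {x y : Fin N} → same x y ≡ false → x ≢ y
same-false⇒≢ {x = x} e refl = false≢true (trans (sym e) (same-refl x))

module Tightness {N : ℕ} (G : Graph N) (simp : IsSimple G) (M : PerfectMatching G)
          (T : Subset N) (forcing : IsForcingSet M T) where
  open Count G simp M T forcing
  open IsSimple simp using (irrefl)

  record Tight : Set where
    field
      cross-complete : ∀ x y → bothOut x y ≡ false → y ≢ x → G x y ≡ true
      inner-exactly-one : ∀ x y → bothOut x y ≡ true → y ≢ x → y ≢ p x → ⟦ G x y ⟧ + ⟦ G (p x) (p y) ⟧ ≡ 1

  gaps0⇒tight : 2 * crossGap + innerGap ≡ 0 → Tight
  gaps0⇒tight gaps≡0 = record { cross-complete = complete ; inner-exactly-one = exactly-one }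
    where
    crossGap≡0 : crossGap ≡ 0
    crossGap≡0 = m+n≡0⇒m≡0 crossGap (m+n≡0⇒m≡0 (2 * crossGap) gaps≡0)
    innerGap≡0 : innerGap ≡ 0
    innerGap≡0 = m+n≡0⇒n≡0 (2 * crossGap) gaps≡0
    crossEdge≡crossPair : ∀ x y → crossEdge x y ≡ crossPair x y
    crossEdge≡crossPair x y = ≤-antisym (crossEdge≤crossPair x y)
      (m∸n≡0⇒m≤n (∑∑-zero (λ x y → crossPair x y ∸ crossEdge x y) crossGap≡0 x y))
    innerEdges≡innerSlots : ∀ x y → innerEdges x y ≡ innerSlots x y
    innerEdges≡innerSlots x y = ≤-antisym (innerEdges≤innerSlots x y)
      (m∸n≡0⇒m≤n (∑∑-zero (λ x y → innerSlots x y ∸ innerEdges x y) innerGap≡0 x y))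
    complete : ∀ x y → bothOut x y ≡ false → y ≢ x → G x y ≡ true
    complete x y out ne = crossEdge≡⇒edge-table (bothOut x y) (G x y) (same y x) out (≢⇒same-false ne) (crossEdge≡crossPair x y)
    exactly-one : ∀ x y → bothOut x y ≡ true → y ≢ x → y ≢ p x → ⟦ G x y ⟧ + ⟦ G (p x) (p y) ⟧ ≡ 1
    exactly-one x y out n1 n2 = innerEdges≡⇒one-table (bothOut x y) (G x y) (G (p x) (p y)) (same y x) (same y (p x))
      out (≢⇒same-false n1) (≢⇒same-false n2) (innerEdges≡innerSlots x y)

  tight⇒crossEdge≡crossPair : Tight → ∀ x y → crossEdge x y ≡ crossPair x y
  tight⇒crossEdge≡crossPair tt x y = crossEdge≡-table (bothOut x y) (G x y) (same y x)
    (λ a e → Tight.cross-complete tt x y a (same-false⇒≢ {x = y} e))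
    (λ e → subst (λ w → G x w ≡ false) (sym (same⇒≡ e)) (irrefl x))

  tight⇒innerEdges≡innerSlots : Tight → ∀ x y → innerEdges x y ≡ innerSlots x y
  tight⇒innerEdges≡innerSlots tt x y = innerEdges≡-table (bothOut x y) (G x y) (G (p x) (p y)) (same y x) (same y (p x))
    (λ _ e → subst (λ w → G x w ≡ false) (sym (same⇒≡ e)) (irrefl x))
    (λ _ e → subst (λ w → G (p x) (p w) ≡ false) (sym (same⇒≡ e)) (irrefl (p x)))
    (λ _ e → ≢⇒same-false {x = y} {y = p x} (λ e' → nofix M x (sym (trans (sym (same⇒≡ {x = y} e)) e'))))
    (λ _ _ e → subst (λ w → G x w ≡ true) (sym (same⇒≡ e)) (edge M x) , subst (λ w → G (p x) (p w) ≡ true) (sym (same⇒≡ e)) (edge M (p x)))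
    (λ a e1 e2 → Tight.inner-exactly-one tt x y a (same-false⇒≢ {x = y} e1) (same-false⇒≢ {x = y} e2))

  tight⇒gaps0 : Tight → 2 * crossGap + innerGap ≡ 0
  tight⇒gaps0 tt = cong₂ (λ a b → 2 * a + b)
    (trans (∑∑-cong (λ x y → trans (cong (_∸ crossEdge x y) (sym (tight⇒crossEdge≡crossPair tt x y))) (n∸n≡0 (crossEdge x y)))) ∑∑-0)
    (trans (∑∑-cong (λ x y → trans (cong (_∸ innerEdges x y) (sym (tight⇒innerEdges≡innerSlots tt x y))) (n∸n≡0 (innerEdges x y)))) ∑∑-0)
    where
    ∑∑-0 : ∑∑ {N} (λ _ _ → 0) ≡ 0
    ∑∑-0 = trans (∑-cong {N} {g = λ _ → 0} (λ x → ∑-0 {N})) (∑-0 {N})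


one-of-true : ∀ {a b} → ⟦ a ⟧ + ⟦ b ⟧ ≡ 1 → a ≡ true → b ≡ false
one-of-true {true} {false} _ _ = refl

one-of-false : ∀ {a b} → ⟦ a ⟧ + ⟦ b ⟧ ≡ 1 → a ≡ false → b ≡ true
one-of-false {false} {true} _ _ = refl

<ᵇ-true : ∀ {a b} → a < b → (a <ᵇ b) ≡ true
<ᵇ-true {a} {b} lt with a <ᵇ b | <⇒<ᵇ lt
... | true | _ = refl

<ᵇ-false : ∀ {a b} → ¬ (a < b) → (a <ᵇ b) ≡ false
<ᵇ-false {a} {b} nlt with a <ᵇ b in e
... | false = refl
... | true = ⊥-elim (nlt (<ᵇ⇒< a b (subst T (sym e) _)))

<ᵇ-true⇒< : ∀ {a b} → (a <ᵇ b) ≡ true → a < b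
<ᵇ-true⇒< {a} {b} e = <ᵇ⇒< a b (subst T (sym e) _)

<ᵇ-false⇒≮ : ∀ {a b} → (a <ᵇ b) ≡ false → ¬ (a < b)
<ᵇ-false⇒≮ e lt = false≢true (trans (sym e) (<ᵇ-true lt))

≡ᵇ-refl : ∀ a → (a ≡ᵇ a) ≡ true
≡ᵇ-refl zero = refl
≡ᵇ-refl (suc a) = ≡ᵇ-refl a

≡ᵇ-false : ∀ {a b} → a ≢ b → (a ≡ᵇ b) ≡ false
≡ᵇ-false {a} {b} ne with a ≡ᵇ b in e
... | false = refl
... | true = ⊥-elim (ne (≡ᵇ⇒≡ a b (subst T (sym e) _)))

≡ᵇ-true⇒≡ : ∀ {a b} → (a ≡ᵇ b) ≡ true → a ≡ b
≡ᵇ-true⇒≡ {a} {b} e = ≡ᵇ⇒≡ a b (subst T (sym e) _)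

-- Adjacency in Ĥ_{m,0} ∨ K_{2k} on positions: u_i is i, v_j is m + j, K_{2k} occupies 2m, 2m + 1, …

ĤAdj : ℕ → ℕ → ℕ → Bool
ĤAdj m p q = if p <ᵇ m then (if q <ᵇ m then false else ((q ∸ m) ≤ᵇ p)) else (if q <ᵇ m then ((p ∸ m) ≤ᵇ q) else not (p ≡ᵇ q))

ĤAdj-UU : ∀ {m p q} → p < m → q < m → ĤAdj m p q ≡ false
ĤAdj-UU {m} {p} {q} a b rewrite <ᵇ-true a | <ᵇ-true b = refl
ĤAdj-UV : ∀ {m p q} → p < m → m ≤ q → ĤAdj m p q ≡ ((q ∸ m) ≤ᵇ p)
ĤAdj-UV {m} {p} {q} a b rewrite <ᵇ-true a | <ᵇ-false (≤⇒≯ b) = refl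
ĤAdj-VU : ∀ {m p q} → m ≤ p → q < m → ĤAdj m p q ≡ ((p ∸ m) ≤ᵇ q)
ĤAdj-VU {m} {p} {q} a b rewrite <ᵇ-false (≤⇒≯ a) | <ᵇ-true b = refl
ĤAdj-VV : ∀ {m p q} → m ≤ p → m ≤ q → ĤAdj m p q ≡ not (p ≡ᵇ q)
ĤAdj-VV {m} {p} {q} a b rewrite <ᵇ-false (≤⇒≯ a) | <ᵇ-false (≤⇒≯ b) = refl
ĤAdj-diag : ∀ m q → ĤAdj m q q ≡ false
ĤAdj-diag m q with q <ᵇ m
... | true = refl
... | false rewrite ≡ᵇ-refl q = refl

≤+⇒∸suc≤∸1 : ∀ {S a b} → 1 ≤ a → S ≤ a + b → S ∸ suc b ≤ a ∸ 1
≤+⇒∸suc≤∸1 {S} {suc a} {b} _ le = m≤n+o⇒m∸n≤o S (suc b) (subst (S ≤_) (cong suc (+-comm a b)) le)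

∸suc≤∸1⇒≤+ : ∀ {S a b} → 1 ≤ a → S ∸ suc b ≤ a ∸ 1 → S ≤ a + b
∸suc≤∸1⇒≤+ {S} {suc a} {b} _ le = ≤-trans (m≤n+m∸n S (suc b)) (subst (_≤ suc a + b) refl (subst (suc b + (S ∸ suc b) ≤_) (cong suc (+-comm b a)) (+-monoʳ-≤ (suc b) le)))

≤-sum-double⇒≡ : ∀ {a b m} → a ≤ m → b ≤ m → a + b ≡ m + m → a ≡ m
≤-sum-double⇒≡ {a} {b} {m} am bm e = ≤-antisym am (+-cancelʳ-≤ m m a (subst (_≤ a + m) e (+-monoʳ-≤ a bm)))

≥-sum-double⇒≡ : ∀ {a b m} → m ≤ a → m ≤ b → a + b ≡ m + m → a ≡ m
≥-sum-double⇒≡ {a} {b} {m} am bm e = ≤-antisym (+-cancelʳ-≤ m a m (subst (a + m ≤_) e (+-monoʳ-≤ a bm))) am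

pred-inj : ∀ {a b} → 1 ≤ a → 1 ≤ b → a ∸ 1 ≡ b ∸ 1 → a ≡ b
pred-inj {suc a} {suc b} _ _ e = cong suc e

∨-true : ∀ {a b} → (a ∨ b) ≡ true → a ≡ true ⊎ b ≡ true
∨-true {true} _ = inj₁ refl
∨-true {false} e = inj₂ e

∨-false : ∀ {a b} → (a ∨ b) ≡ false → a ≡ false × b ≡ false
∨-false {false} {false} _ = refl , refl

∧-false : ∀ {a b} → (a ∧ b) ≡ false → a ≡ false ⊎ b ≡ false
∧-false {false} _ = inj₁ refl
∧-false {true} e = inj₂ e

≤-double⇒1≤ : ∀ {m d} → m ≤ d → suc d ≤ m + m → 1 ≤ m
≤-double⇒1≤ {zero} _ ()
≤-double⇒1≤ {suc m} _ _ = s≤s z≤n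

joinAdj : ℕ → ℕ → ℕ → Bool
joinAdj m p q = if p <ᵇ (m + m) then (if q <ᵇ (m + m) then ĤAdj m p q else true) else (if q <ᵇ (m + m) then true else not (p ≡ᵇ q))

≡ᵇ-+ : ∀ m p q → ((m + p) ≡ᵇ (m + q)) ≡ (p ≡ᵇ q)
≡ᵇ-+ zero p q = refl
≡ᵇ-+ (suc m) p q = ≡ᵇ-+ m p q

joinAdj-TT : ∀ {m p q} → m + m ≤ p → m + m ≤ q → joinAdj m p q ≡ not (p ≡ᵇ q)
joinAdj-TT {m} {p} {q} a b rewrite <ᵇ-false (≤⇒≯ a) | <ᵇ-false (≤⇒≯ b) = refl
joinAdj-TO : ∀ {m p q} → m + m ≤ p → q < m + m → joinAdj m p q ≡ true
joinAdj-TO {m} {p} {q} a b rewrite <ᵇ-false (≤⇒≯ a) | <ᵇ-true b = refl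
joinAdj-OT : ∀ {m p q} → p < m + m → m + m ≤ q → joinAdj m p q ≡ true
joinAdj-OT {m} {p} {q} a b rewrite <ᵇ-true a | <ᵇ-false (≤⇒≯ b) = refl
joinAdj-OO : ∀ {m p q} → p < m + m → q < m + m → joinAdj m p q ≡ ĤAdj m p q
joinAdj-OO {m} {p} {q} a b rewrite <ᵇ-true a | <ᵇ-true b = refl

-- A tight forcing set determines Ĥ_{n-t,0} ∨ K_{2t}

module TightStructure {N : ℕ} (G : Graph N) (simp : IsSimple G) (M : PerfectMatching G)
          (T : Subset N) (forcing : IsForcingSet M T) (tt : Tightness.Tight G simp M T forcing) where
  open Count G simp M T forcing public
  open Tightness G simp M T forcing using (Tight; tight⇒innerEdges≡innerSlots)
  open Tight tt public
  open IsSimple simp renaming (sym to gsym)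

  Outside⇒out : ∀ {x} → Outside x → o x ≡ true
  Outside⇒out e = cong not e

  bothOut-Outside : ∀ {x} → Outside x → ∀ w → bothOut x w ≡ o w
  bothOut-Outside {x} ox w rewrite Outside⇒out {x} ox = refl

  Outside-partner : ∀ {x} → Outside x → Outside (p x)
  Outside-partner {x} ox = trans (inT-partner x) ox

  outDeg : Fin N → ℕ
  outDeg x = ∑ (λ w → ⟦ o w ∧ G x w ⟧)

  outDeg-partner : ∀ x → outDeg (p x) ≡ ∑ (λ w → ⟦ o w ∧ G (p x) (p w) ⟧)
  outDeg-partner x = trans (sym (∑-partner (λ w → ⟦ o w ∧ G (p x) w ⟧))) (∑-cong (λ w → cong (λ b → ⟦ b ∧ G (p x) (p w) ⟧) (out-partner w)))

  outDeg+outDeg-partner : ∀ {x} → Outside x → outDeg x + outDeg (p x) ≡ nO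
  outDeg+outDeg-partner {x} ox = trans (cong (outDeg x +_) (outDeg-partner x))
    (trans (sym (∑-+ (λ w → ⟦ o w ∧ G x w ⟧) (λ w → ⟦ o w ∧ G (p x) (p w) ⟧)))
    (trans (∑-cong (λ w → trans (cong₂ (λ a b → ⟦ a ∧ G x w ⟧ + ⟦ b ∧ G (p x) (p w) ⟧) (sym (bothOut-Outside ox w)) (sym (bothOut-Outside ox w))) (tight⇒innerEdges≡innerSlots tt x w)))
    (trans (∑-innerSlots x) (trans (cong (λ b → ⟦ b ⟧ * nO) (Outside⇒out {x} ox)) (+-identityʳ nO)))))

  outDeg≥1 : ∀ {x} → Outside x → 1 ≤ outDeg x
  outDeg≥1 {x} ox = subst (_≤ outDeg x) partner-term≡1 (term≤∑ (λ w → ⟦ o w ∧ G x w ⟧) (p x))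
    where
    partner-term≡1 : ⟦ o (p x) ∧ G x (p x) ⟧ ≡ 1
    partner-term≡1 = cong₂ (λ a b → ⟦ a ∧ b ⟧) (Outside⇒out (Outside-partner ox)) (edge M x)

  -- An O-neighbour w of My outside {x , Mx , y , My} is a neighbour of x: otherwise tightness
  -- gives Mw Mx ∈ G and the edges xy, My w, Mw Mx close an M-alternating 6-cycle.
  module _ {x y : Fin N} (ox : Outside x) (oy : Outside y) (yx : y ≢ x) (ypx : y ≢ p x) (gxy : G x y ≡ true) where
    private
      PointwiseBound : Fin N → Set
      PointwiseBound w = ⟦ o w ∧ G (p y) w ⟧ + ⟦ same w (p x) ⟧ + ⟦ same w (p y) ⟧ * ⟦ G x (p y) ⟧ ≤ ⟦ o w ∧ G x w ⟧ + ⟦ same w x ⟧ * ⟦ G (p y) x ⟧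
      oxT = Outside⇒out {x} ox
      oyT = Outside⇒out {y} oy
      opxT = Outside⇒out {p x} (Outside-partner ox)
      opyT = Outside⇒out {p y} (Outside-partner oy)
      xpx : x ≢ p x
      xpx e = nofix M x (sym e)
      xpy : x ≢ p y
      xpy = ≢partner-sym ypx
      pxpy : p x ≢ p y
      pxpy e = yx (sym (partner-injective e))
      ypy : y ≢ p y
      ypy e = nofix M y (sym e)
      gpxpy : G (p x) (p y) ≡ false
      gpxpy = one-of-true (inner-exactly-one x y (trans (cong (_∧ o y) oxT) oyT) yx ypx) gxy
      gpypx : G (p y) (p x) ≡ false
      gpypx = trans (gsym (p y) (p x)) gpxpy
      gpyy : G (p y) y ≡ true
      gpyy = trans (cong (G (p y)) (sym (invol M y))) (edge M (p y))
      gxpx : G x (p x) ≡ true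
      gxpx = edge M x

      bound-at-x : PointwiseBound x
      bound-at-x rewrite oxT | ≢⇒same-false xpx | ≢⇒same-false xpy | same-refl x | irrefl x with G (p y) x
      ... | true = ≤-refl
      ... | false = ≤-refl
      bound-at-Mx : PointwiseBound (p x)
      bound-at-Mx rewrite opxT | same-refl (p x) | ≢⇒same-false pxpy | ≢⇒same-false (λ e → xpx (sym e)) | gpypx | gxpx = ≤-refl
      bound-at-y : PointwiseBound y
      bound-at-y rewrite oyT | ≢⇒same-false ypx | ≢⇒same-false ypy | ≢⇒same-false yx | gpyy | gxy = ≤-refl
      bound-at-My : PointwiseBound (p y)
      bound-at-My rewrite opyT | ≢⇒same-false (λ e → pxpy (sym e)) | same-refl (p y) | ≢⇒same-false (λ e → xpy (sym e)) | irrefl (p y) with G x (p y)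
      ... | true = ≤-refl
      ... | false = ≤-refl

      bound-elsewhere : ∀ w → w ≢ x → w ≢ p x → w ≢ y → w ≢ p y → PointwiseBound w
      bound-elsewhere w wx wpx wy wpy rewrite ≢⇒same-false wx | ≢⇒same-false wpx | ≢⇒same-false wpy with o w in eow
      ... | false = z≤n
      ... | true with G x w in egxw
      ... | true = +-monoˡ-≤ 0 (+-monoˡ-≤ 0 (⟦⟧≤1 (G (p y) w)))
      ... | false with G (p y) w in egpyw
      ... | false = z≤n
      ... | true = ⊥-elim (no-alternating-6-cycle {x} {p y} {p w} ox (Outside-partner oy) (Outside-partner (not-true eow))
              (λ e → xpy (sym e)) (λ e → wpx (trans (sym (invol M w)) (cong p e)))
              (λ e → wy (partner-injective e)) (λ e → pxpy (sym e)) (λ e → wx (partner-injective e))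
              (λ e → wpy (partner-injective e))
              (trans (cong (G x) (invol M y)) gxy) (trans (cong (G (p y)) (invol M w)) egpyw)
              (trans (gsym (p w) (p x)) (one-of-false (inner-exactly-one x w (trans (cong (_∧ o w) oxT) eow) wx wpx) egxw)))

    outDeg-partner<outDeg-pointwise : ∀ w → PointwiseBound w
    outDeg-partner<outDeg-pointwise w = go (w FP.≟ x) (w FP.≟ p x) (w FP.≟ y) (w FP.≟ p y)
      where
      go : Dec (w ≡ x) → Dec (w ≡ p x) → Dec (w ≡ y) → Dec (w ≡ p y) → PointwiseBound w
      go (yes e) _ _ _ = subst PointwiseBound (sym e) bound-at-x
      go _ (yes e) _ _ = subst PointwiseBound (sym e) bound-at-Mx
      go _ _ (yes e) _ = subst PointwiseBound (sym e) bound-at-y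
      go _ _ _ (yes e) = subst PointwiseBound (sym e) bound-at-My
      go (no a) (no b) (no c) (no d) = bound-elsewhere w a b c d

    outDeg-partner<outDeg : suc (outDeg (p y)) ≤ outDeg x
    outDeg-partner<outDeg = +-cancelʳ-≤ ⟦ G x (p y) ⟧ (suc (outDeg (p y))) (outDeg x) le
      where
      ∑-lhs : ∑ (λ w → ⟦ o w ∧ G (p y) w ⟧ + ⟦ same w (p x) ⟧ + ⟦ same w (p y) ⟧ * ⟦ G x (p y) ⟧) ≡ suc (outDeg (p y)) + ⟦ G x (p y) ⟧
      ∑-lhs = trans (∑-+ (λ w → ⟦ o w ∧ G (p y) w ⟧ + ⟦ same w (p x) ⟧) (λ w → ⟦ same w (p y) ⟧ * ⟦ G x (p y) ⟧))
            (cong₂ _+_ (trans (∑-+ (λ w → ⟦ o w ∧ G (p y) w ⟧) (λ w → ⟦ same w (p x) ⟧))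
                        (trans (cong (outDeg (p y) +_) (trans (∑-cong {N} {f = λ w → ⟦ same w (p x) ⟧} (λ w → sym (*-identityʳ _))) (∑-point (λ _ → 1) (p x)))) (+-comm (outDeg (p y)) 1)))
                       (∑-point (λ _ → ⟦ G x (p y) ⟧) (p y)))
      ∑-rhs : ∑ (λ w → ⟦ o w ∧ G x w ⟧ + ⟦ same w x ⟧ * ⟦ G (p y) x ⟧) ≡ outDeg x + ⟦ G x (p y) ⟧
      ∑-rhs = trans (∑-+ (λ w → ⟦ o w ∧ G x w ⟧) (λ w → ⟦ same w x ⟧ * ⟦ G (p y) x ⟧))
            (cong (outDeg x +_) (trans (∑-point (λ _ → ⟦ G (p y) x ⟧) x) (cong ⟦_⟧ (gsym (p y) x))))
      le : suc (outDeg (p y)) + ⟦ G x (p y) ⟧ ≤ outDeg x + ⟦ G x (p y) ⟧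
      le = subst₂ _≤_ ∑-lhs ∑-rhs (∑-mono outDeg-partner<outDeg-pointwise)

  adjacent⇒nO<outDeg+outDeg : ∀ {x y} → Outside x → Outside y → y ≢ x → y ≢ p x → G x y ≡ true → suc nO ≤ outDeg x + outDeg y
  adjacent⇒nO<outDeg+outDeg {x} {y} ox oy yx ypx g = subst₂ _≤_ (trans (+-suc (outDeg y) (outDeg (p y))) (cong suc (outDeg+outDeg-partner oy))) (+-comm (outDeg y) (outDeg x))
                                   (+-monoʳ-≤ (outDeg y) (outDeg-partner<outDeg ox oy yx ypx g))

  nonadjacent⇒outDeg+outDeg<nO : ∀ {x y} → Outside x → Outside y → y ≢ x → y ≢ p x → G x y ≡ false → suc (outDeg x + outDeg y) ≤ nO
  nonadjacent⇒outDeg+outDeg<nO {x} {y} ox oy yx ypx g = subst₂ _≤_ (trans (+-suc (outDeg x) (outDeg y)) refl) (outDeg+outDeg-partner ox) (+-monoʳ-≤ (outDeg x) cl)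
    where
    g' : G (p x) (p y) ≡ true
    g' = one-of-false (inner-exactly-one x y (trans (cong (_∧ o y) (Outside⇒out {x} ox)) (Outside⇒out {y} oy)) yx ypx) g
    cl : suc (outDeg y) ≤ outDeg (p x)
    cl = subst (λ z → suc (outDeg z) ≤ outDeg (p x)) (invol M y)
           (outDeg-partner<outDeg (Outside-partner ox) (Outside-partner oy) (λ e → yx (partner-injective e)) (λ e → ypx (trans (sym (invol M y)) (trans (cong p e) (invol M (p x))))) g')

  outDeg-injective : ∀ {x y} → Outside x → Outside y → y ≢ x → y ≢ p x → outDeg x ≢ outDeg y
  outDeg-injective {x} {y} ox oy yx ypx eq with G x (p y) in g
  ... | true = <⇒≢ (+-cancelʳ-≤ (outDeg (p y)) (suc (outDeg y)) (outDeg x)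
                  (subst (_≤ outDeg x + outDeg (p y)) (cong suc (sym (outDeg+outDeg-partner oy))) (adjacent⇒nO<outDeg+outDeg ox (Outside-partner oy) a b g))) (sym eq)
    where a : p y ≢ x
          a e = ypx (trans (sym (invol M y)) (cong p e))
          b : p y ≢ p x
          b e = yx (partner-injective e)
  ... | false = <⇒≢ (+-cancelʳ-≤ (outDeg (p y)) (suc (outDeg x)) (outDeg y)
                  (subst (suc (outDeg x + outDeg (p y)) ≤_) (sym (outDeg+outDeg-partner oy)) (nonadjacent⇒outDeg+outDeg<nO ox (Outside-partner oy) a b g))) eq
    where a : p y ≢ x
          a e = ypx (trans (sym (invol M y)) (cong p e))
          b : p y ≢ p x
          b e = yx (partner-injective e)

  outDeg<nO : ∀ {x} → Outside x → suc (outDeg x) ≤ nO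
  outDeg<nO {x} ox = subst (suc (outDeg x) ≤_) (outDeg+outDeg-partner ox) (subst (_≤ outDeg x + outDeg (p x)) (+-comm (outDeg x) 1) (+-monoʳ-≤ (outDeg x) (outDeg≥1 (Outside-partner ox))))

  module Positions (m : ℕ) (hm : nO ≡ m + m) where
    S : ℕ
    S = m + m
    inU : Fin N → Bool
    inU x = (outDeg x <ᵇ m) ∨ ((outDeg x ≡ᵇ m) ∧ (toℕ x <ᵇ toℕ (p x)))
    -- The sides U, V of Ĥ_{m,0} are read off the O-degrees: u_i has degree i + 1 and v_j has
    -- degree 2m - 1 - j; a matching edge with both ends of degree m is split by vertex index.
    position : Fin N → ℕ
    position x = if inU x then outDeg x ∸ 1 else m + (S ∸ suc (outDeg x))

    data Side (x : Fin N) : Set where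
      U : outDeg x ≤ m → position x ≡ outDeg x ∸ 1 → (outDeg x ≡ m → toℕ x < toℕ (p x)) → Side x
      V : m ≤ outDeg x → position x ≡ m + (S ∸ suc (outDeg x)) → (outDeg x ≡ m → toℕ (p x) ≤ toℕ x) → Side x

    side : ∀ x → Side x
    side x with inU x in e
    ... | true = U le (cong (λ b → if b then outDeg x ∸ 1 else m + (S ∸ suc (outDeg x))) e) imp
      where
      le : outDeg x ≤ m
      le with ∨-true {outDeg x <ᵇ m} e
      ... | inj₁ a = <⇒≤ (<ᵇ-true⇒< a)
      ... | inj₂ b = ≤-reflexive (≡ᵇ-true⇒≡ (proj₁ (∧-true b)))
      imp : outDeg x ≡ m → toℕ x < toℕ (p x)
      imp dm with ∨-true {outDeg x <ᵇ m} e
      ... | inj₁ a = ⊥-elim (<⇒≢ (<ᵇ-true⇒< a) dm)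
      ... | inj₂ b = <ᵇ-true⇒< (proj₂ (∧-true b))
    ... | false = V (≮⇒≥ (<ᵇ-false⇒≮ (proj₁ (∨-false {outDeg x <ᵇ m} e)))) (cong (λ b → if b then outDeg x ∸ 1 else m + (S ∸ suc (outDeg x))) e) imp
      where
      imp : outDeg x ≡ m → toℕ (p x) ≤ toℕ x
      imp dm with ∧-false {outDeg x ≡ᵇ m} (proj₂ (∨-false {outDeg x <ᵇ m} e))
      ... | inj₁ a = ⊥-elim (false≢true (trans (sym a) (subst (λ z → (outDeg x ≡ᵇ z) ≡ true) dm (≡ᵇ-refl (outDeg x)))))
      ... | inj₂ b = ≮⇒≥ (<ᵇ-false⇒≮ b)

    outDeg<2m : ∀ {x} → Outside x → suc (outDeg x) ≤ S
    outDeg<2m {x} ox = subst (suc (outDeg x) ≤_) hm (outDeg<nO ox)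

    outDeg∸1<m : ∀ {x} → Outside x → outDeg x ≤ m → outDeg x ∸ 1 < m
    outDeg∸1<m {x} ox le with outDeg x | outDeg≥1 ox
    ... | suc d | _ = le

    m≥1 : ∀ {x} → Outside x → m ≤ outDeg x → 1 ≤ m
    m≥1 {x} ox le = ≤-double⇒1≤ le (outDeg<2m ox)

    2m∸suc-outDeg<m : ∀ {x} → Outside x → m ≤ outDeg x → S ∸ suc (outDeg x) < m
    2m∸suc-outDeg<m {x} ox le = <-≤-trans (s≤s (≤+⇒∸suc≤∸1 {S} {m} {outDeg x} (m≥1 ox le) (+-monoʳ-≤ m le))) (≤-reflexive (lem (m≥1 ox le)))
      where lem : ∀ {k} → 1 ≤ k → suc (k ∸ 1) ≡ k
            lem {suc k} _ = refl

    position<2m : ∀ {x} → Outside x → position x < S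
    position<2m {x} ox with side x
    ... | U le e _ = subst (_< S) (sym e) (<-≤-trans (outDeg∸1<m ox le) (m≤m+n m m))
    ... | V le e _ = subst (_< S) (sym e) (+-monoʳ-< m (2m∸suc-outDeg<m ox le))

    outDeg+outDeg-partner≡2m : ∀ {x} → Outside x → outDeg x + outDeg (p x) ≡ S
    outDeg+outDeg-partner≡2m ox = trans (outDeg+outDeg-partner ox) hm

    m≤m+ : ∀ {x} → m ≤ m + (S ∸ suc (outDeg x))
    m≤m+ = m≤m+n _ _

    position-partner-adjacent : ∀ {x} → Outside x → ĤAdj m (position x) (position (p x)) ≡ true
    position-partner-adjacent {x} ox with side x | side (p x)
    ... | U lx ex ix | U lpx epx ipx = ⊥-elim (<-asym (ix dxm) (subst (λ z → toℕ (p x) < toℕ z) (invol M x) (ipx dpxm)))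
      where dxm = ≤-sum-double⇒≡ lx lpx (outDeg+outDeg-partner≡2m ox)
            dpxm = ≤-sum-double⇒≡ lpx lx (trans (+-comm (outDeg (p x)) (outDeg x)) (outDeg+outDeg-partner≡2m ox))
    ... | V lx ex ix | V lpx epx ipx = ⊥-elim (nofix M x (sym (FP.toℕ-injective (≤-antisym (subst (λ z → toℕ z ≤ toℕ (p x)) (invol M x) (ipx dpxm)) (ix dxm)))))
      where dxm = ≥-sum-double⇒≡ lx lpx (outDeg+outDeg-partner≡2m ox)
            dpxm = ≥-sum-double⇒≡ lpx lx (trans (+-comm (outDeg (p x)) (outDeg x)) (outDeg+outDeg-partner≡2m ox))
    ... | U lx ex _ | V lpx epx _ rewrite ex | epx =
      trans (ĤAdj-UV (outDeg∸1<m ox lx) (m≤m+ {p x})) (trans (cong (_≤ᵇ (outDeg x ∸ 1)) (m+n∸m≡n m (S ∸ suc (outDeg (p x)))))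
        (≤ᵇ-true (≤+⇒∸suc≤∸1 (outDeg≥1 ox) (≤-reflexive (sym (outDeg+outDeg-partner≡2m ox))))))
    ... | V lx ex _ | U lpx epx _ rewrite ex | epx =
      trans (ĤAdj-VU (m≤m+ {x}) (outDeg∸1<m (Outside-partner ox) lpx)) (trans (cong (_≤ᵇ (outDeg (p x) ∸ 1)) (m+n∸m≡n m (S ∸ suc (outDeg x))))
        (≤ᵇ-true (≤+⇒∸suc≤∸1 (outDeg≥1 (Outside-partner ox)) (≤-reflexive (sym (trans (+-comm (outDeg (p x)) (outDeg x)) (outDeg+outDeg-partner≡2m ox)))))))

    position-adjacency : ∀ {x y} → Outside x → Outside y → y ≢ x → y ≢ p x → G x y ≡ ĤAdj m (position x) (position y)
    position-adjacency {x} {y} ox oy yx ypx with side x | side y | G x y in g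
    ... | U lx ex _ | U ly ey _ | true = ⊥-elim (1+n≰n (≤-trans (adjacent⇒nO<outDeg+outDeg ox oy yx ypx g) (subst (outDeg x + outDeg y ≤_) (sym hm) (+-mono-≤ lx ly))))
    ... | U lx ex _ | U ly ey _ | false rewrite ex | ey = sym (ĤAdj-UU (outDeg∸1<m ox lx) (outDeg∸1<m oy ly))
    ... | V lx ex _ | V ly ey _ | false = ⊥-elim (1+n≰n (≤-trans (nonadjacent⇒outDeg+outDeg<nO ox oy yx ypx g) (subst (_≤ outDeg x + outDeg y) (sym hm) (+-mono-≤ lx ly))))
    ... | V lx ex _ | V ly ey _ | true rewrite ex | ey = sym (trans (ĤAdj-VV (m≤m+ {x}) (m≤m+ {y})) (cong not (≡ᵇ-false ne)))
      where ne : m + (S ∸ suc (outDeg x)) ≢ m + (S ∸ suc (outDeg y))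
            ne e = outDeg-injective ox oy yx ypx (suc-injective (∸-cancelˡ-≡ (outDeg<2m ox) (outDeg<2m oy) (+-cancelˡ-≡ m _ _ e)))
    ... | U lx ex _ | V ly ey _ | true rewrite ex | ey =
      sym (trans (ĤAdj-UV (outDeg∸1<m ox lx) (m≤m+ {y})) (trans (cong (_≤ᵇ (outDeg x ∸ 1)) (m+n∸m≡n m (S ∸ suc (outDeg y))))
        (≤ᵇ-true (≤+⇒∸suc≤∸1 (outDeg≥1 ox) (subst (_≤ outDeg x + outDeg y) hm (<⇒≤ (adjacent⇒nO<outDeg+outDeg ox oy yx ypx g)))))))
    ... | U lx ex _ | V ly ey _ | false rewrite ex | ey =
      sym (trans (ĤAdj-UV (outDeg∸1<m ox lx) (m≤m+ {y})) (trans (cong (_≤ᵇ (outDeg x ∸ 1)) (m+n∸m≡n m (S ∸ suc (outDeg y))))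
        (≤ᵇ-false (λ le → 1+n≰n (≤-trans (nonadjacent⇒outDeg+outDeg<nO ox oy yx ypx g) (subst (_≤ outDeg x + outDeg y) (sym hm) (∸suc≤∸1⇒≤+ (outDeg≥1 ox) le)))))))
    ... | V lx ex _ | U ly ey _ | true rewrite ex | ey =
      sym (trans (ĤAdj-VU (m≤m+ {x}) (outDeg∸1<m oy ly)) (trans (cong (_≤ᵇ (outDeg y ∸ 1)) (m+n∸m≡n m (S ∸ suc (outDeg x))))
        (≤ᵇ-true (≤+⇒∸suc≤∸1 (outDeg≥1 oy) (subst (_≤ outDeg y + outDeg x) hm (<⇒≤ (subst (suc nO ≤_) (+-comm (outDeg x) (outDeg y)) (adjacent⇒nO<outDeg+outDeg ox oy yx ypx g))))))))
    ... | V lx ex _ | U ly ey _ | false rewrite ex | ey =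
      sym (trans (ĤAdj-VU (m≤m+ {x}) (outDeg∸1<m oy ly)) (trans (cong (_≤ᵇ (outDeg y ∸ 1)) (m+n∸m≡n m (S ∸ suc (outDeg x))))
        (≤ᵇ-false (λ le → 1+n≰n (≤-trans (nonadjacent⇒outDeg+outDeg<nO ox oy yx ypx g) (subst (_≤ outDeg x + outDeg y) (sym hm) (subst (S ≤_) (+-comm (outDeg y) (outDeg x)) (∸suc≤∸1⇒≤+ (outDeg≥1 oy) le))))))))

    G≡ĤAdj-position : ∀ {x y} → Outside x → Outside y → G x y ≡ ĤAdj m (position x) (position y)
    G≡ĤAdj-position {x} {y} ox oy = go (y FP.≟ x) (y FP.≟ p x)
      where
      go : Dec (y ≡ x) → Dec (y ≡ p x) → G x y ≡ ĤAdj m (position x) (position y)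
      go (yes e) _ = subst (λ w → G x w ≡ ĤAdj m (position x) (position w)) (sym e) (trans (irrefl x) (sym (ĤAdj-diag m (position x))))
      go (no yx) (yes e) = subst (λ w → G x w ≡ ĤAdj m (position x) (position w)) (sym e) (trans (edge M x) (sym (position-partner-adjacent ox)))
      go (no yx) (no ypx) = position-adjacency ox oy yx ypx

    position-injective : ∀ {x y} → Outside x → Outside y → position x ≡ position y → x ≡ y
    position-injective {x} {y} ox oy pe with side x | side y
    ... | U lx ex ix | U ly ey iy = fin (pred-inj (outDeg≥1 ox) (outDeg≥1 oy) (trans (sym ex) (trans pe ey)))
      where
      fin : outDeg x ≡ outDeg y → x ≡ y
      fin dxy with y FP.≟ x | y FP.≟ p x
      ... | yes e | _ = sym e
      ... | no yx | no ypx = ⊥-elim (outDeg-injective ox oy yx ypx dxy)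
      ... | no yx | yes e = ⊥-elim (<-asym (ix dxm) (subst (λ z → toℕ (p x) < toℕ z) (invol M x) (subst (λ w → toℕ w < toℕ (p w)) e (iy (trans (sym dxy) dxm)))))
        where
        dxm : outDeg x ≡ m
        dxm = ≤-sum-double⇒≡ lx (subst (_≤ m) (cong outDeg e) ly) (outDeg+outDeg-partner≡2m ox)
    ... | U lx ex _ | V ly ey _ = ⊥-elim (<⇒≱ (outDeg∸1<m ox lx) (subst (m ≤_) (trans (sym ey) (trans (sym pe) ex)) (m≤m+ {y})))
    ... | V lx ex _ | U ly ey _ = ⊥-elim (<⇒≱ (outDeg∸1<m oy ly) (subst (m ≤_) (trans (sym ex) (trans pe ey)) (m≤m+ {x})))
    ... | V lx ex ix | V ly ey iy = fin (suc-injective (∸-cancelˡ-≡ (outDeg<2m ox) (outDeg<2m oy) (+-cancelˡ-≡ m _ _ (trans (sym ex) (trans pe ey)))))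
      where
      fin : outDeg x ≡ outDeg y → x ≡ y
      fin dxy with y FP.≟ x | y FP.≟ p x
      ... | yes e | _ = sym e
      ... | no yx | no ypx = ⊥-elim (outDeg-injective ox oy yx ypx dxy)
      ... | no yx | yes e = ⊥-elim (nofix M x (sym (FP.toℕ-injective (≤-antisym
              (subst (λ z → toℕ z ≤ toℕ (p x)) (invol M x) (subst (λ w → toℕ (p w) ≤ toℕ w) e (iy (trans (sym dxy) dxm))))
              (ix dxm)))))
        where
        dxm : outDeg x ≡ m
        dxm = ≥-sum-double⇒≡ lx (subst (m ≤_) (cong outDeg e) ly) (outDeg+outDeg-partner≡2m ox)

    rank : Fin N → ℕ
    rank x = ∑ (λ w → ⟦ inT w ∧ (toℕ w <ᵇ toℕ x) ⟧)

    rank-bound : ∀ x → rank x + ⟦ inT x ⟧ ≤ nT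
    rank-bound x = subst (_≤ nT) (trans (∑-+ (λ w → ⟦ inT w ∧ (toℕ w <ᵇ toℕ x) ⟧) (λ w → ⟦ same w x ⟧ * ⟦ inT w ⟧)) (cong (rank x +_) (∑-point (λ w → ⟦ inT w ⟧) x)))
                     (∑-mono pw)
      where
      pw : ∀ w → ⟦ inT w ∧ (toℕ w <ᵇ toℕ x) ⟧ + ⟦ same w x ⟧ * ⟦ inT w ⟧ ≤ ⟦ inT w ⟧
      pw w with same w x in e | inT w
      ... | true | true rewrite <ᵇ-false {toℕ w} {toℕ x} (λ lt → <-irrefl (cong toℕ (same⇒≡ e)) lt) = ≤-refl
      ... | true | false = z≤n
      ... | false | true = subst (_≤ 1) (sym (+-identityʳ _)) (⟦⟧≤1 (toℕ w <ᵇ toℕ x))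
      ... | false | false = z≤n

    rank-mono : ∀ {x y} → toℕ x < toℕ y → rank x + ⟦ inT x ⟧ ≤ rank y
    rank-mono {x} {y} xy = subst (_≤ rank y) (trans (∑-+ (λ w → ⟦ inT w ∧ (toℕ w <ᵇ toℕ x) ⟧) (λ w → ⟦ same w x ⟧ * ⟦ inT w ⟧)) (cong (rank x +_) (∑-point (λ w → ⟦ inT w ⟧) x)))
                     (∑-mono pw)
      where
      pw : ∀ w → ⟦ inT w ∧ (toℕ w <ᵇ toℕ x) ⟧ + ⟦ same w x ⟧ * ⟦ inT w ⟧ ≤ ⟦ inT w ∧ (toℕ w <ᵇ toℕ y) ⟧
      pw w with same w x in e | inT w
      ... | true | true rewrite <ᵇ-false {toℕ w} {toℕ x} (λ lt → <-irrefl (cong toℕ (same⇒≡ e)) lt)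
                              | <ᵇ-true {toℕ w} {toℕ y} (subst (_< toℕ y) (sym (cong toℕ (same⇒≡ e))) xy) = ≤-refl
      ... | true | false = z≤n
      ... | false | false = z≤n
      ... | false | true with toℕ w <ᵇ toℕ x in e2
      ... | false = z≤n
      ... | true rewrite <ᵇ-true {toℕ w} {toℕ y} (<-trans (<ᵇ-true⇒< e2) xy) = ≤-refl

    rank-injective : ∀ {x y} → inT x ≡ true → inT y ≡ true → rank x ≡ rank y → x ≡ y
    rank-injective {x} {y} tx ty e with <-cmp (toℕ x) (toℕ y)
    ... | tri≈ _ q _ = FP.toℕ-injective q
    ... | tri< lt _ _ = ⊥-elim (1+n≰n (subst (_≤ rank y) (trans (cong (λ b → rank x + ⟦ b ⟧) tx) (trans (+-comm (rank x) 1) (cong suc e))) (rank-mono lt)))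
    ... | tri> _ _ gt = ⊥-elim (1+n≰n (subst (_≤ rank x) (trans (cong (λ b → rank y + ⟦ b ⟧) ty) (trans (+-comm (rank y) 1) (cong suc (sym e)))) (rank-mono gt)))

    module Embedding (k : ℕ) (hk : nT ≡ k + k) where
      index : Fin N → ℕ
      index x = if inT x then S + rank x else position x

      index-covered : ∀ {x} → inT x ≡ true → index x ≡ S + rank x
      index-covered {x} e = cong (λ b → if b then S + rank x else position x) e
      index-outside : ∀ {x} → inT x ≡ false → index x ≡ position x
      index-outside {x} e = cong (λ b → if b then S + rank x else position x) e

      index< : ∀ x → index x < S + (k + k)
      index< x = go (inT x) refl
        where
        go : (b : Bool) → inT x ≡ b → index x < S + (k + k)
        go true e = subst (_< S + (k + k)) (sym (index-covered e)) (+-monoʳ-< S (subst (_≤ k + k) (trans (cong (λ b → rank x + ⟦ b ⟧) e) (+-comm (rank x) 1)) (subst (rank x + ⟦ inT x ⟧ ≤_) hk (rank-bound x))))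
        go false e = subst (_< S + (k + k)) (sym (index-outside e)) (<-≤-trans (position<2m e) (m≤m+n S (k + k)))

      index-injective : ∀ {x y} → index x ≡ index y → x ≡ y
      index-injective {x} {y} pe = go (inT x) (inT y) refl refl
        where
        go : (bx by : Bool) → inT x ≡ bx → inT y ≡ by → x ≡ y
        go true true ex ey = rank-injective ex ey (+-cancelˡ-≡ S _ _ (trans (sym (index-covered ex)) (trans pe (index-covered ey))))
        go true false ex ey = ⊥-elim (<⇒≱ (position<2m ey) (subst (S ≤_) (trans (sym (index-covered ex)) (trans pe (index-outside ey))) (m≤m+n S (rank x))))
        go false true ex ey = ⊥-elim (<⇒≱ (position<2m ex) (subst (S ≤_) (trans (sym (index-covered ey)) (trans (sym pe) (index-outside ex))) (m≤m+n S (rank y))))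
        go false false ex ey = position-injective ex ey (trans (sym (index-outside ex)) (trans pe (index-outside ey)))

      G≡joinAdj-index : ∀ x y → G x y ≡ joinAdj m (index x) (index y)
      G≡joinAdj-index x y = go (inT x) (inT y) refl refl
        where
        go : (bx by : Bool) → inT x ≡ bx → inT y ≡ by → G x y ≡ joinAdj m (index x) (index y)
        go true true ex ey = trans (same-block (y FP.≟ x)) (sym (trans (cong₂ (joinAdj m) (index-covered ex) (index-covered ey)) (trans (joinAdj-TT {m} (m≤m+n S (rank x)) (m≤m+n S (rank y))) (cong not (≡ᵇ-+ S (rank x) (rank y))))))
          where
          same-block : Dec (y ≡ x) → G x y ≡ not (rank x ≡ᵇ rank y)
          same-block (yes e) rewrite e | ≡ᵇ-refl (rank x) = irrefl x
          same-block (no ne) rewrite ≡ᵇ-false (λ r → ne (sym (rank-injective ex ey r))) = cross-complete x y (cong (λ b → not b ∧ o y) ex) ne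
        go true false ex ey = trans (cross-complete x y (cong (λ b → not b ∧ o y) ex) (λ e → false≢true (trans (sym ey) (trans (cong inT e) ex))))
                                (sym (trans (cong₂ (joinAdj m) (index-covered ex) (index-outside ey)) (joinAdj-TO {m} (m≤m+n S (rank x)) (position<2m ey))))
        go false true ex ey = trans (cross-complete x y (trans (cong (λ b → o x ∧ not b) ey) (∧-zeroʳ (o x))) (λ e → false≢true (trans (sym ex) (trans (cong inT (sym e)) ey))))
                                (sym (trans (cong₂ (joinAdj m) (index-outside ex) (index-covered ey)) (joinAdj-OT {m} (position<2m ex) (m≤m+n S (rank y)))))
        go false false ex ey = trans (G≡ĤAdj-position ex ey) (sym (trans (cong₂ (joinAdj m) (index-outside ex) (index-outside ey)) (joinAdj-OO {m} (position<2m ex) (position<2m ey))))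


toℕ-L : ∀ {a b} {i : Fin (a + b)} {x} → splitAt a i ≡ inj₁ x → toℕ i ≡ toℕ x
toℕ-L {a} {b} {i} {x} e = trans (cong toℕ (sym (FP.splitAt⁻¹-↑ˡ e))) (FP.toℕ-↑ˡ x b)

toℕ-R : ∀ {a b} {i : Fin (a + b)} {x} → splitAt a i ≡ inj₂ x → toℕ i ≡ a + toℕ x
toℕ-R {a} {b} {i} {x} e = trans (cong toℕ (sym (FP.splitAt⁻¹-↑ʳ e))) (FP.toℕ-↑ʳ a x)


Hhat≡ĤAdj : ∀ m (i j : Fin (m + m)) → Hhat m i j ≡ ĤAdj m (toℕ i) (toℕ j)
Hhat≡ĤAdj m i j with splitAt m i in e1 | splitAt m j in e2
... | inj₁ a | inj₁ b rewrite toℕ-L e1 | toℕ-L e2 = sym (ĤAdj-UU (FP.toℕ<n a) (FP.toℕ<n b))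
... | inj₁ a | inj₂ b rewrite toℕ-L e1 | toℕ-R e2 = sym (trans (ĤAdj-UV (FP.toℕ<n a) (m≤m+n m (toℕ b))) (cong (_≤ᵇ toℕ a) (m+n∸m≡n m (toℕ b))))
... | inj₂ a | inj₁ b rewrite toℕ-R e1 | toℕ-L e2 = sym (trans (ĤAdj-VU (m≤m+n m (toℕ a)) (FP.toℕ<n b)) (cong (_≤ᵇ toℕ b) (m+n∸m≡n m (toℕ a))))
... | inj₂ a | inj₂ b rewrite toℕ-R e1 | toℕ-R e2 = sym (trans (ĤAdj-VV (m≤m+n m (toℕ a)) (m≤m+n m (toℕ b))) (cong not (≡ᵇ-+ m (toℕ a) (toℕ b))))

join≡joinAdj : ∀ m k (i j : Fin ((m + m) + (k + k))) → join (Hhat m) (Complete (k + k)) i j ≡ joinAdj m (toℕ i) (toℕ j)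
join≡joinAdj m k i j with splitAt (m + m) i in e1 | splitAt (m + m) j in e2
... | inj₁ a | inj₁ b rewrite toℕ-L e1 | toℕ-L e2 | <ᵇ-true (FP.toℕ<n a) | <ᵇ-true (FP.toℕ<n b) = Hhat≡ĤAdj m a b
... | inj₁ a | inj₂ b rewrite toℕ-L e1 | toℕ-R e2 | <ᵇ-true (FP.toℕ<n a) | <ᵇ-false (≤⇒≯ (m≤m+n (m + m) (toℕ b))) = refl
... | inj₂ a | inj₁ b rewrite toℕ-R e1 | toℕ-L e2 | <ᵇ-false (≤⇒≯ (m≤m+n (m + m) (toℕ a))) | <ᵇ-true (FP.toℕ<n b) = refl
... | inj₂ a | inj₂ b rewrite toℕ-R e1 | toℕ-R e2 | <ᵇ-false (≤⇒≯ (m≤m+n (m + m) (toℕ a))) | <ᵇ-false (≤⇒≯ (m≤m+n (m + m) (toℕ b))) = cong not (sym (≡ᵇ-+ (m + m) (toℕ a) (toℕ b)))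


injective⇒surjective : ∀ {a} (f : Fin a → Fin a) → (∀ {x y} → f x ≡ f y → x ≡ y) → ∀ y → Σ (Fin a) (λ x → f x ≡ y)
injective⇒surjective {suc a} f inj y with FP.any? (λ x → f x FP.≟ y)
... | yes (x , e) = x , e
... | no ne with FP.pigeonhole (n<1+n a) (λ x → punchOut {i = y} {j = f x} (λ e → ne (x , sym e)))
... | i , j , i<j , eq = ⊥-elim (<-irrefl (cong toℕ (inj (FP.punchOut-injective (λ e → ne (i , sym e)) (λ e → ne (j , sym e)) eq))) i<j)

injection↔ : ∀ {a b} → a ≡ b → (f : Fin a → Fin b) → (∀ {x y} → f x ≡ f y → x ≡ y) → Fin a ↔ Fin b
injection↔ refl f inj = mk↔ₛ′ f (λ y → proj₁ (injective⇒surjective f inj y)) (λ y → proj₂ (injective⇒surjective f inj y)) (λ x → inj (proj₂ (injective⇒surjective f inj (f x))))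

injection↔-to : ∀ {a b} (e : a ≡ b) (f : Fin a → Fin b) (inj : ∀ {x y} → f x ≡ f y → x ≡ y) → ∀ x → Inverse.to (injection↔ e f inj) x ≡ f x
injection↔-to refl f inj x = refl


nonempty-interval⇒1≤ : ∀ {S k x} → S ≤ x → x < S + k → 1 ≤ k
nonempty-interval⇒1≤ {S} {zero} {x} a b = ⊥-elim (<⇒≱ b (subst (_≤ x) (sym (+-identityʳ S)) a))
nonempty-interval⇒1≤ {S} {suc k} _ _ = s≤s z≤n

+-positive-≢ : ∀ {x d} → 1 ≤ d → x + d ≢ x
+-positive-≢ {x} {d} le e with +-cancelˡ-≡ x d 0 (trans e (sym (+-identityʳ x)))
+-positive-≢ {x} {.0} () e | refl

-- Ĥ_{m,0} ∨ K_{2k} attains the bound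

module ExtremalGraph (m k : ℕ) where
  S : ℕ
  S = m + m
  A : ℕ
  A = S + (k + k)

  -- The matching u_i v_i on Ĥ_{m,0} and 2m + i ↔ 2m + k + i on K_{2k}.
  partnerℕ : ℕ → ℕ
  partnerℕ x = if x <ᵇ m then x + m else (if x <ᵇ S then x ∸ m else (if x <ᵇ S + k then x + k else x ∸ k))

  data Block (x : ℕ) : Set where
    inU : x < m → Block x
    inV : m ≤ x → x < S → Block x
    inK₁ : S ≤ x → x < S + k → Block x
    inK₂ : S + k ≤ x → x < A → Block x

  block : ∀ {x} → x < A → Block x
  block {x} lt with x <? m | x <? S | x <? S + k
  ... | yes a | _ | _ = inU a
  ... | no a | yes b | _ = inV (≮⇒≥ a) b
  ... | no a | no b | yes c = inK₁ (≮⇒≥ b) c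
  ... | no a | no b | no c = inK₂ (≮⇒≥ c) (subst (x <_) refl lt)

  partnerℕ-U : ∀ {x} → x < m → partnerℕ x ≡ x + m
  partnerℕ-U a rewrite <ᵇ-true a = refl
  partnerℕ-V : ∀ {x} → m ≤ x → x < S → partnerℕ x ≡ x ∸ m
  partnerℕ-V a b rewrite <ᵇ-false (≤⇒≯ a) | <ᵇ-true b = refl
  partnerℕ-K₁ : ∀ {x} → S ≤ x → x < S + k → partnerℕ x ≡ x + k
  partnerℕ-K₁ {x} a b rewrite <ᵇ-false {x} {m} (λ lt → ≤⇒≯ a (<-≤-trans lt (m≤m+n m m))) | <ᵇ-false (≤⇒≯ a) | <ᵇ-true b = refl
  partnerℕ-K₂ : ∀ {x} → S + k ≤ x → partnerℕ x ≡ x ∸ k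
  partnerℕ-K₂ {x} a rewrite <ᵇ-false {x} {m} (λ lt → ≤⇒≯ a (<-≤-trans lt (≤-trans (m≤m+n m m) (m≤m+n S k))))
                  | <ᵇ-false {x} {S} (λ lt → ≤⇒≯ a (<-≤-trans lt (m≤m+n S k))) | <ᵇ-false (≤⇒≯ a) = refl

  U+m∈V : ∀ {x} → x < m → m ≤ x + m × x + m < S
  U+m∈V {x} a = m≤n+m m x , +-monoˡ-< m a
  V∸m<m : ∀ {x} → m ≤ x → x < S → x ∸ m < m
  V∸m<m {x} a b = subst (x ∸ m <_) (m+n∸n≡m m m) (∸-monoˡ-< b a)

  2m≤K₂∸k : ∀ {x} → S + k ≤ x → S ≤ x ∸ k
  2m≤K₂∸k {x} a = m+n≤o⇒m≤o∸n S a
  K₂∸k<2m+k : ∀ {x} → S + k ≤ x → x < A → x ∸ k < S + k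
  K₂∸k<2m+k {x} a b = subst (x ∸ k <_) (m+n∸m≡n k (S + k)) (∸-monoˡ-< (subst (x <_) (sym (trans (+-comm k (S + k)) (+-assoc S k k))) b) (≤-trans (m≤n+m k S) a))

  record PartnerFacts (x : ℕ) : Set where
    field
      lt : partnerℕ x < A
      inv : partnerℕ (partnerℕ x) ≡ x
      ne : partnerℕ x ≢ x
      preserves-Ĥ : x < S → partnerℕ x < S
      preserves-K : S ≤ x → S ≤ partnerℕ x
      edge : joinAdj m x (partnerℕ x) ≡ true

  partnerFacts : ∀ {x} → x < A → PartnerFacts x
  partnerFacts {x} xA with block xA
  ... | inU a = record
    { lt = subst (_< A) (sym (partnerℕ-U a)) (<-≤-trans (proj₂ (U+m∈V a)) (m≤m+n S (k + k)))
    ; inv = trans (cong partnerℕ (partnerℕ-U a)) (trans (partnerℕ-V (proj₁ (U+m∈V a)) (proj₂ (U+m∈V a))) (m+n∸n≡m x m))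
    ; ne = λ e → +-positive-≢ (≤-trans (s≤s z≤n) a) (trans (sym (partnerℕ-U a)) e)
    ; preserves-Ĥ = λ _ → subst (_< S) (sym (partnerℕ-U a)) (proj₂ (U+m∈V a))
    ; preserves-K = λ s → ⊥-elim (<⇒≱ (<-≤-trans a (m≤m+n m m)) s)
    ; edge = trans (cong (joinAdj m x) (partnerℕ-U a)) (trans (joinAdj-OO {m} (<-≤-trans a (m≤m+n m m)) (proj₂ (U+m∈V a)))
             (trans (ĤAdj-UV a (proj₁ (U+m∈V a))) (trans (cong (_≤ᵇ x) (m+n∸n≡m x m)) (≤ᵇ-true (≤-refl {x}))))) }
  ... | inV a b = record
    { lt = subst (_< A) (sym (partnerℕ-V a b)) (<-≤-trans (<-≤-trans (V∸m<m a b) (m≤m+n m m)) (m≤m+n S (k + k)))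
    ; inv = trans (cong partnerℕ (partnerℕ-V a b)) (trans (partnerℕ-U (V∸m<m a b)) (m∸n+n≡m a))
    ; ne = λ e → <⇒≱ (V∸m<m a b) (subst (m ≤_) (sym (trans (sym (partnerℕ-V a b)) e)) a)
    ; preserves-Ĥ = λ _ → subst (_< S) (sym (partnerℕ-V a b)) (<-≤-trans (V∸m<m a b) (m≤m+n m m))
    ; preserves-K = λ s → ⊥-elim (<⇒≱ b s)
    ; edge = trans (cong (joinAdj m x) (partnerℕ-V a b)) (trans (joinAdj-OO {m} b (<-≤-trans (V∸m<m a b) (m≤m+n m m)))
             (trans (ĤAdj-VU a (V∸m<m a b)) (≤ᵇ-true (≤-refl {x ∸ m})))) }
  ... | inK₁ a b = record
    { lt = subst (_< A) (sym (partnerℕ-K₁ a b)) (subst (x + k <_) (+-assoc S k k) (+-monoˡ-< k b))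
    ; inv = trans (cong partnerℕ (partnerℕ-K₁ a b)) (trans (partnerℕ-K₂ (+-monoˡ-≤ k a)) (m+n∸n≡m x k))
    ; ne = λ e → +-positive-≢ (nonempty-interval⇒1≤ a b) (trans (sym (partnerℕ-K₁ a b)) e)
    ; preserves-Ĥ = λ s → ⊥-elim (<⇒≱ s a)
    ; preserves-K = λ _ → subst (S ≤_) (sym (partnerℕ-K₁ a b)) (≤-trans a (m≤m+n x k))
    ; edge = trans (cong (joinAdj m x) (partnerℕ-K₁ a b)) (trans (joinAdj-TT {m} a (≤-trans a (m≤m+n x k)))
             (cong not (≡ᵇ-false (λ e → ne' (sym e))))) }
    where
    ne' : x + k ≢ x
    ne' = +-positive-≢ (nonempty-interval⇒1≤ a b)
  ... | inK₂ a b = record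
    { lt = subst (_< A) (sym (partnerℕ-K₂ a)) (<-≤-trans (K₂∸k<2m+k a b) (+-monoʳ-≤ S (m≤m+n k k)))
    ; inv = trans (cong partnerℕ (partnerℕ-K₂ a)) (trans (partnerℕ-K₁ (2m≤K₂∸k a) (K₂∸k<2m+k a b)) (m∸n+n≡m (≤-trans (m≤n+m k S) a)))
    ; ne = λ e → ne' (trans (sym (partnerℕ-K₂ a)) e)
    ; preserves-Ĥ = λ s → ⊥-elim (<⇒≱ s (≤-trans (m≤m+n S k) a))
    ; preserves-K = λ _ → subst (S ≤_) (sym (partnerℕ-K₂ a)) (2m≤K₂∸k a)
    ; edge = trans (cong (joinAdj m x) (partnerℕ-K₂ a)) (trans (joinAdj-TT {m} (≤-trans (m≤m+n S k) a) (2m≤K₂∸k a))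
             (cong not (≡ᵇ-false (λ e → ne' (sym e))))) }
    where
    ne' : x ∸ k ≢ x
    ne' e = <⇒≱ (K₂∸k<2m+k a b) (subst (S + k ≤_) (sym e) a)

  partnerFactsFin : (a : Fin A) → PartnerFacts (toℕ a)
  partnerFactsFin a = partnerFacts (FP.toℕ<n a)

  ≤ᵇ-exactly-one : ∀ {a b} → a ≢ b → ⟦ a ≤ᵇ b ⟧ + ⟦ b ≤ᵇ a ⟧ ≡ 1
  ≤ᵇ-exactly-one {a} {b} ne with <-cmp a b
  ... | tri< lt _ _ = cong₂ (λ u v → ⟦ u ⟧ + ⟦ v ⟧) (≤ᵇ-true (<⇒≤ lt)) (≤ᵇ-false (<⇒≱ lt))
  ... | tri≈ _ e _ = ⊥-elim (ne e)
  ... | tri> _ _ gt = cong₂ (λ u v → ⟦ u ⟧ + ⟦ v ⟧) (≤ᵇ-false (<⇒≱ gt)) (≤ᵇ-true (<⇒≤ gt))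

  joinAdj-cross-complete : ∀ {x y} → x ≢ y → S ≤ x ⊎ S ≤ y → joinAdj m x y ≡ true
  joinAdj-cross-complete {x} {y} ne (inj₁ sx) with y <? S
  ... | yes yS = joinAdj-TO {m} sx yS
  ... | no yS = trans (joinAdj-TT {m} sx (≮⇒≥ yS)) (cong not (≡ᵇ-false ne))
  joinAdj-cross-complete {x} {y} ne (inj₂ sy) with x <? S
  ... | yes xS = joinAdj-OT {m} xS sy
  ... | no xS = trans (joinAdj-TT {m} (≮⇒≥ xS) sy) (cong not (≡ᵇ-false ne))

  joinAdj-inner-exactly-one : ∀ {x y} → x < S → y < S → y ≢ x → y ≢ partnerℕ x → ⟦ joinAdj m x y ⟧ + ⟦ joinAdj m (partnerℕ x) (partnerℕ y) ⟧ ≡ 1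
  joinAdj-inner-exactly-one {x} {y} xS yS yx ypx =
    trans (cong₂ (λ u v → ⟦ u ⟧ + ⟦ v ⟧) (joinAdj-OO {m} xS yS) (joinAdj-OO {m} (PartnerFacts.preserves-Ĥ ix xS) (PartnerFacts.preserves-Ĥ iy yS))) (go (x <? m) (y <? m))
    where
    ix = partnerFacts (<-≤-trans xS (m≤m+n S (k + k)))
    iy = partnerFacts (<-≤-trans yS (m≤m+n S (k + k)))
    go : Dec (x < m) → Dec (y < m) → ⟦ ĤAdj m x y ⟧ + ⟦ ĤAdj m (partnerℕ x) (partnerℕ y) ⟧ ≡ 1
    ⟦⟧+⟦⟧-cong = cong₂ (λ u v → ⟦ u ⟧ + ⟦ v ⟧)
    go (yes a) (yes b) = trans (⟦⟧+⟦⟧-cong (ĤAdj-UU a b) (trans (cong₂ (ĤAdj m) (partnerℕ-U a) (partnerℕ-U b)) (ĤAdj-VV (m≤n+m m x) (m≤n+m m y))))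
      (cong (λ z → ⟦ not z ⟧) (≡ᵇ-false (λ e → yx (sym (+-cancelʳ-≡ m x y e)))))
    go (yes a) (no b) = trans (⟦⟧+⟦⟧-cong (ĤAdj-UV a (≮⇒≥ b)) (trans (cong₂ (ĤAdj m) (partnerℕ-U a) (partnerℕ-V (≮⇒≥ b) yS)) (trans (ĤAdj-VU (m≤n+m m x) (V∸m<m (≮⇒≥ b) yS)) (cong (_≤ᵇ (y ∸ m)) (m+n∸n≡m x m)))))
      (≤ᵇ-exactly-one (λ e → ypx (trans (sym (m∸n+n≡m (≮⇒≥ b))) (trans (cong (_+ m) e) (sym (partnerℕ-U a))))))
    go (no a) (yes b) = trans (⟦⟧+⟦⟧-cong (ĤAdj-VU (≮⇒≥ a) b) (trans (cong₂ (ĤAdj m) (partnerℕ-V (≮⇒≥ a) xS) (partnerℕ-U b)) (trans (ĤAdj-UV (V∸m<m (≮⇒≥ a) xS) (m≤n+m m y)) (cong (_≤ᵇ (x ∸ m)) (m+n∸n≡m y m)))))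
      (≤ᵇ-exactly-one (λ e → ypx (trans (sym e) (sym (partnerℕ-V (≮⇒≥ a) xS)))))
    go (no a) (no b) = trans (⟦⟧+⟦⟧-cong (ĤAdj-VV (≮⇒≥ a) (≮⇒≥ b)) (trans (cong₂ (ĤAdj m) (partnerℕ-V (≮⇒≥ a) xS) (partnerℕ-V (≮⇒≥ b) yS)) (ĤAdj-UU (V∸m<m (≮⇒≥ a) xS) (V∸m<m (≮⇒≥ b) yS))))
      (cong (λ z → ⟦ not z ⟧ + 0) (≡ᵇ-false (λ e → yx (sym e))))

  -- A perfect matching q agreeing with partnerℕ on K_{2k} matches u_i to v_i, by induction on i:
  -- the neighbours of u_i in V are v_0, …, v_i, and v_0, …, v_(i-1) are already used.
  module Forced (q : Fin A → Fin A) (qinv : ∀ a → q (q a) ≡ a) (qe : ∀ a → joinAdj m (toℕ a) (toℕ (q a)) ≡ true)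
              (qT : ∀ a → S ≤ toℕ a → toℕ (q a) ≡ partnerℕ (toℕ a)) where
    ForcedAt : ℕ → Set
    ForcedAt i = i < m → ∀ a → toℕ a ≡ i → toℕ (q a) ≡ i + m

    <m⇒<A : ∀ {i} → i < m → i < A
    <m⇒<A lt = <-≤-trans lt (≤-trans (m≤m+n m m) (m≤m+n S (k + k)))

    forced-step : ∀ i → (∀ j → j < i → ForcedAt j) → ForcedAt i
    forced-step i ih im a ai with toℕ (q a) <? S
    ... | no yS = ⊥-elim (<⇒≱ (<-≤-trans im (m≤m+n m m)) (subst (S ≤_) (trans (sym (qT (q a) (≮⇒≥ yS))) (trans (cong toℕ (qinv a)) ai)) (PartnerFacts.preserves-K (partnerFactsFin (q a)) (≮⇒≥ yS))))
    ... | yes yS with toℕ (q a) <? m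
    ...   | yes ym = ⊥-elim (false≢true (trans (sym (ĤAdj-UU (subst (_< m) (sym ai) im) ym)) (trans (sym (joinAdj-OO {m} (subst (_< S) (sym ai) (<-≤-trans im (m≤m+n m m))) yS)) (qe a))))
    ...   | no ym = fin
      where
      y = toℕ (q a)
      le : y ∸ m ≤ i
      le = subst (λ z → y ∸ m ≤ z) ai (≤ᵇ⇒≤ (y ∸ m) (toℕ a) (subst T (sym (trans (sym (ĤAdj-UV (subst (_< m) (sym ai) im) (≮⇒≥ ym))) (trans (sym (joinAdj-OO {m} (subst (_< S) (sym ai) (<-≤-trans im (m≤m+n m m))) yS)) (qe a)))) _))
      fin : y ≡ i + m
      fin with m≤n⇒m<n∨m≡n le
      ... | inj₂ e = trans (sym (m∸n+n≡m (≮⇒≥ ym))) (cong (_+ m) e)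
      ... | inj₁ lt = ⊥-elim (<-irrefl (sym (trans (sym ai) (trans (cong toℕ aa') (FP.toℕ-fromℕ< (<m⇒<A jm))))) lt)
        where
        jm : y ∸ m < m
        jm = <-trans lt im
        a' = fromℕ< (<m⇒<A jm)
        qa' : q a' ≡ q a
        qa' = FP.toℕ-injective (trans (ih (y ∸ m) lt jm a' (FP.toℕ-fromℕ< (<m⇒<A jm))) (m∸n+n≡m (≮⇒≥ ym)))
        aa' : a ≡ a'
        aa' = trans (sym (qinv a)) (trans (cong q (sym qa')) (qinv a'))

    forced-below : ∀ n i → i < n → ForcedAt i
    forced-below (suc n) i (s≤s le) = forced-step i (λ j j<i → forced-below n j (≤-trans j<i le))

    forced : ∀ a → toℕ (q a) ≡ partnerℕ (toℕ a)
    forced a with toℕ a <? m | toℕ a <? S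
    ... | yes am | _ = trans (forced-below (suc (toℕ a)) (toℕ a) ≤-refl am a refl) (sym (partnerℕ-U am))
    ... | no am | yes aS = trans (cong toℕ qa) (trans (FP.toℕ-fromℕ< (<m⇒<A jm)) (sym (partnerℕ-V (≮⇒≥ am) aS)))
      where
      jm : toℕ a ∸ m < m
      jm = V∸m<m (≮⇒≥ am) aS
      a' = fromℕ< (<m⇒<A jm)
      qa'a : q a' ≡ a
      qa'a = FP.toℕ-injective (trans (forced-below (suc (toℕ a ∸ m)) (toℕ a ∸ m) ≤-refl jm a' (FP.toℕ-fromℕ< (<m⇒<A jm))) (m∸n+n≡m (≮⇒≥ am)))
      qa : q a ≡ a'
      qa = trans (cong q (sym qa'a)) (qinv a')
    ... | no am | no aS = qT a (≮⇒≥ aS)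


not∧not≡false : ∀ {a b} → (not a ∧ not b) ≡ false → a ≡ true ⊎ b ≡ true
not∧not≡false {true} _ = inj₁ refl
not∧not≡false {false} {true} _ = inj₂ refl

not∧not≡true : ∀ {a b} → (not a ∧ not b) ≡ true → a ≡ false × b ≡ false
not∧not≡true {false} {false} _ = refl , refl

double-injective : ∀ {a b} → a + a ≡ b + b → a ≡ b
double-injective {a} {b} e with <-cmp a b
... | tri< lt _ _ = ⊥-elim (<-irrefl e (+-mono-< lt lt))
... | tri≈ _ q _ = q
... | tri> _ _ gt = ⊥-elim (<-irrefl (sym e) (+-mono-< gt gt))

module ExtremalForcing {n : ℕ} (G : Graph (2 * n)) (simp : IsSimple G) (k : ℕ)
            (ψ : Fin (2 * n) ↔ Fin (((n ∸ k) + (n ∸ k)) + (k + k)))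
            (hψ : ∀ i j → G i j ≡ join (Hhat (n ∸ k)) (Complete (k + k)) (Inverse.to ψ i) (Inverse.to ψ j)) where
  m = n ∸ k
  open ExtremalGraph m k

  ψt = Inverse.to ψ
  ψf = Inverse.from ψ
  ψtf : ∀ a → ψt (ψf a) ≡ a
  ψtf = Inverse.strictlyInverseˡ ψ
  ψft : ∀ x → ψf (ψt x) ≡ x
  ψft = Inverse.strictlyInverseʳ ψ

  pos : Fin (2 * n) → ℕ
  pos x = toℕ (ψt x)

  G≡joinAdj : ∀ i j → G i j ≡ joinAdj m (pos i) (pos j)
  G≡joinAdj i j = trans (hψ i j) (join≡joinAdj m k (ψt i) (ψt j))

  partnerFin : Fin A → Fin A
  partnerFin a = fromℕ< (PartnerFacts.lt (partnerFactsFin a))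
  toℕ-partnerFin : ∀ a → toℕ (partnerFin a) ≡ partnerℕ (toℕ a)
  toℕ-partnerFin a = FP.toℕ-fromℕ< _
  partnerFin-involutive : ∀ a → partnerFin (partnerFin a) ≡ a
  partnerFin-involutive a = FP.toℕ-injective (trans (toℕ-partnerFin (partnerFin a)) (trans (cong partnerℕ (toℕ-partnerFin a)) (PartnerFacts.inv (partnerFactsFin a))))

  partnerₑ : Fin (2 * n) → Fin (2 * n)
  partnerₑ x = ψf (partnerFin (ψt x))
  pos-partnerₑ : ∀ x → pos (partnerₑ x) ≡ partnerℕ (pos x)
  pos-partnerₑ x = trans (cong toℕ (ψtf (partnerFin (ψt x)))) (toℕ-partnerFin (ψt x))

  matchingₑ : PerfectMatching G
  matchingₑ = record
    { partner = partnerₑ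
    ; invol = λ x → trans (cong (λ z → ψf (partnerFin z)) (ψtf (partnerFin (ψt x)))) (trans (cong ψf (partnerFin-involutive (ψt x))) (ψft x))
    ; nofix = λ x e → PartnerFacts.ne (partnerFactsFin (ψt x)) (trans (sym (pos-partnerₑ x)) (cong pos e))
    ; edge = λ x → trans (G≡joinAdj x (partnerₑ x)) (trans (cong (joinAdj m (pos x)) (pos-partnerₑ x)) (PartnerFacts.edge (partnerFactsFin (ψt x)))) }

  coveredₑ : Subset (2 * n)
  coveredₑ = tabulate (λ x → S ≤ᵇ pos x)
  lookup-coveredₑ : ∀ x → lookup coveredₑ x ≡ (S ≤ᵇ pos x)
  lookup-coveredₑ x = lookup∘tabulate (λ x → S ≤ᵇ pos x) x

  coveredₑ⇒2m≤pos : ∀ {x} → lookup coveredₑ x ≡ true → S ≤ pos x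
  coveredₑ⇒2m≤pos {x} e = ≤ᵇ⇒≤ S (pos x) (subst T (sym (trans (sym (lookup-coveredₑ x)) e)) _)
  2m≤pos⇒coveredₑ : ∀ {x} → S ≤ pos x → lookup coveredₑ x ≡ true
  2m≤pos⇒coveredₑ {x} le = trans (lookup-coveredₑ x) (≤ᵇ-true le)
  uncoveredₑ⇒pos<2m : ∀ {x} → lookup coveredₑ x ≡ false → pos x < S
  uncoveredₑ⇒pos<2m {x} e = ≰⇒> (λ le → false≢true (trans (sym e) (2m≤pos⇒coveredₑ le)))

  coveredₑ-closed : SubsetOfMatching matchingₑ coveredₑ
  coveredₑ-closed u uT = lookup⇒[]= (partnerₑ u) coveredₑ (2m≤pos⇒coveredₑ (subst (S ≤_) (sym (pos-partnerₑ u)) (PartnerFacts.preserves-K (partnerFactsFin (ψt u)) (coveredₑ⇒2m≤pos ([]=⇒lookup uT)))))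

  forcingₑ : IsForcingSet matchingₑ coveredₑ
  forcingₑ = coveredₑ-closed , forces
    where
    forces : (M' : PerfectMatching G) → (∀ u → u ∈ coveredₑ → partner M' u ≡ partnerₑ u) → ∀ u → partner M' u ≡ partnerₑ u
    forces M' agree u = trans (sym (ψft (partner M' u))) (trans (cong ψf (trans (cong (λ z → ψt (partner M' z)) (sym (ψft u))) qeq)) refl)
      where
      q : Fin A → Fin A
      q a = ψt (partner M' (ψf a))
      qinv : ∀ a → q (q a) ≡ a
      qinv a = trans (cong (λ z → ψt (partner M' z)) (ψft (partner M' (ψf a)))) (trans (cong ψt (invol M' (ψf a))) (ψtf a))
      qe : ∀ a → joinAdj m (toℕ a) (toℕ (q a)) ≡ true
      qe a = trans (cong (λ z → joinAdj m (toℕ z) (toℕ (q a))) (sym (ψtf a))) (trans (sym (G≡joinAdj (ψf a) (partner M' (ψf a)))) (edge M' (ψf a)))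
      qT : ∀ a → S ≤ toℕ a → toℕ (q a) ≡ partnerℕ (toℕ a)
      qT a le = trans (cong (λ z → toℕ (ψt z)) (agree (ψf a) (lookup⇒[]= (ψf a) coveredₑ (2m≤pos⇒coveredₑ (subst (S ≤_) (sym (cong toℕ (ψtf a))) le)))))
                  (trans (pos-partnerₑ (ψf a)) (cong (λ z → partnerℕ (toℕ z)) (ψtf a)))
      qeq : q (ψt u) ≡ partnerFin (ψt u)
      qeq = FP.toℕ-injective (trans (Forced.forced q qinv qe qT (ψt u)) (sym (toℕ-partnerFin (ψt u))))

  open Count G simp matchingₑ coveredₑ forcingₑ using (bothOut; nT; nT≡2∣S∣)
  open Tightness G simp matchingₑ coveredₑ forcingₑ using (Tight; tight⇒gaps0)

  pos-injective : ∀ {x y} → pos x ≡ pos y → x ≡ y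
  pos-injective e = trans (sym (ψft _)) (trans (cong ψf (FP.toℕ-injective e)) (ψft _))

  tightₑ : Tight
  tightₑ = record { cross-complete = t1 ; inner-exactly-one = t2 }
    where
    t1 : ∀ x y → bothOut x y ≡ false → y ≢ x → G x y ≡ true
    t1 x y a ne = trans (G≡joinAdj x y) (joinAdj-cross-complete (λ e → ne (sym (pos-injective e))) side)
      where side : S ≤ pos x ⊎ S ≤ pos y
            side with not∧not≡false {lookup coveredₑ x} a
            ... | inj₁ e = inj₁ (coveredₑ⇒2m≤pos e)
            ... | inj₂ e = inj₂ (coveredₑ⇒2m≤pos e)
    t2 : ∀ x y → bothOut x y ≡ true → y ≢ x → y ≢ partnerₑ x → ⟦ G x y ⟧ + ⟦ G (partnerₑ x) (partnerₑ y) ⟧ ≡ 1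
    t2 x y a n1 n2 = trans (cong₂ (λ u v → ⟦ u ⟧ + ⟦ v ⟧) (G≡joinAdj x y) (trans (G≡joinAdj (partnerₑ x) (partnerₑ y)) (cong₂ (joinAdj m) (pos-partnerₑ x) (pos-partnerₑ y))))
                      (joinAdj-inner-exactly-one (uncoveredₑ⇒pos<2m (proj₁ (not∧not≡true {lookup coveredₑ x} a))) (uncoveredₑ⇒pos<2m (proj₂ (not∧not≡true {lookup coveredₑ x} a)))
                         (λ e → n1 (pos-injective e)) (λ e → n2 (pos-injective (trans e (sym (pos-partnerₑ x))))))

  nT≡2k : nT ≡ k + k
  nT≡2k = trans (∑-cong (λ x → cong ⟦_⟧ (lookup-coveredₑ x))) (trans (∑-permute ψ (λ a → ⟦ S ≤ᵇ toℕ a ⟧))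
          (trans (∑-splitAt S (λ a → ⟦ S ≤ᵇ toℕ a ⟧))
            (cong₂ _+_ (trans (∑-cong (λ i → cong ⟦_⟧ (≤ᵇ-false (λ le → <⇒≱ (subst (_< S) (sym (FP.toℕ-↑ˡ i (k + k))) (FP.toℕ<n i)) le)))) (∑-0 {S}))
                       (trans (∑-cong {k + k} {g = λ _ → 1} (λ j → cong ⟦_⟧ (≤ᵇ-true (subst (S ≤_) (sym (FP.toℕ-↑ʳ S j)) (m≤m+n S (toℕ j)))))) (∑-1 {k + k})))))

  edgesOf-coveredₑ : edgesOf matchingₑ coveredₑ ≡ k
  edgesOf-coveredₑ = double-injective (trans (sym nT≡2∣S∣) nT≡2k)

  gapsₑ≡0 = tight⇒gaps0 tightₑ


^2-cancel-≤ : ∀ {a b} → a ^ 2 ≤ b ^ 2 → a ≤ b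
^2-cancel-≤ {a} {b} le with a ≤? b
... | yes p = p
... | no np = ⊥-elim (<⇒≱ (^-monoˡ-< 2 (≰⇒> np)) le)

sizeA : ∀ x y → 2 * (x + y) ≡ (x + x) + (y + y)
sizeA = solve-∀

sizeEq : ∀ n f → f ≤ n → 2 * n ≡ ((n ∸ f) + (n ∸ f)) + (f + f)
sizeEq n f le = trans (cong (2 *_) (sym (m∸n+n≡m le))) (sizeA (n ∸ f) f)

forcingSet-boundHolds : ∀ {n} (G : Graph (2 * n)) → IsSimple G → (M : PerfectMatching G) (T : Subset (2 * n)) →
  IsForcingSet M T → BoundHolds n (edgeCount G) (edgesOf M T)
forcingSet-boundHolds {n} G simp M T forcing with n ≤? edgesOf M T
... | yes n≤t = inj₁ n≤t
... | no n≰t = inj₂ (subst ((2 * n ∸ (1 + 2 * t)) ^ 2 + 4 * e ≤_) (bound-identity (≰⇒> n≰t)) (m≤m+n _ gaps))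
  where open Bound {n} G simp M T forcing

boundTight⇒≤forcingSet : ∀ {n k} (G : Graph (2 * n)) → IsSimple G → BoundTight n (edgeCount G) k →
  (M : PerfectMatching G) (T : Subset (2 * n)) → IsForcingSet M T → k ≤ edgesOf M T
boundTight⇒≤forcingSet {n} {k} G simp (k<n , tight) M T forcing with n ≤? edgesOf M T
... | yes n≤t = <⇒≤ (<-≤-trans k<n n≤t)
... | no n≰t = *-cancelˡ-≤ 2 (s≤s⁻¹ (∸-cancelʳ-≤ 1+2k≤2n (^2-cancel-≤ squares≤)))
  where
  open Bound {n} G simp M T forcing
  squares≤ : (2 * n ∸ (1 + 2 * t)) ^ 2 ≤ (2 * n ∸ (1 + 2 * k)) ^ 2
  squares≤ = +-cancelʳ-≤ (4 * e) _ _
    (subst ((2 * n ∸ (1 + 2 * t)) ^ 2 + 4 * e ≤_) (trans (bound-identity (≰⇒> n≰t)) (sym tight)) (m≤m+n _ gaps))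
  1+2k≤2n : 1 + 2 * k ≤ 2 * n
  1+2k≤2n = ≤-trans (s≤s (+-monoʳ-≤ k (n≤1+n (k + 0)))) (*-monoʳ-≤ 2 k<n)

boundTight⇒extremal : ∀ {n} (G : Graph (2 * n)) → IsSimple G → (M : PerfectMatching G) (T : Subset (2 * n)) →
  IsForcingSet M T → BoundTight n (edgeCount G) (edgesOf M T) →
  G ≅ join (Hhat (n ∸ edgesOf M T)) (Complete (edgesOf M T + edgesOf M T))
boundTight⇒extremal {n} G simp M T forcing (t<n , tight) = injection↔ size φ φ-injective , G≡join
  where
  module B = Bound {n} G simp M T forcing
  gaps≡0 : B.gaps ≡ 0
  gaps≡0 = +-cancelˡ-≡ _ _ _ (trans (B.bound-identity t<n) (sym (trans (+-identityʳ _) tight)))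
  open TightStructure G simp M T forcing (Tightness.gaps0⇒tight G simp M T forcing gaps≡0)
  t = edgesOf M T
  m = n ∸ t
  size : 2 * n ≡ (m + m) + (t + t)
  size = sizeEq n t (<⇒≤ t<n)
  nT≡2t : nT ≡ t + t
  nT≡2t = nT≡2∣S∣
  nO≡2m : nO ≡ m + m
  nO≡2m = +-cancelʳ-≡ (t + t) nO (m + m) (trans (cong (nO +_) (sym nT≡2t)) (trans nO+nT≡N size))
  open Positions.Embedding m nO≡2m t nT≡2t
  φ : Fin (2 * n) → Fin ((m + m) + (t + t))
  φ x = fromℕ< (index< x)
  toℕ-φ : ∀ x → toℕ (φ x) ≡ index x
  toℕ-φ x = FP.toℕ-fromℕ< (index< x)
  φ-injective : ∀ {x y} → φ x ≡ φ y → x ≡ y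
  φ-injective {x} {y} e = index-injective (trans (sym (toℕ-φ x)) (trans (cong toℕ e) (toℕ-φ y)))
  G≡join : ∀ i j → G i j ≡ join (Hhat m) (Complete (t + t)) (Inverse.to (injection↔ size φ φ-injective) i) (Inverse.to (injection↔ size φ φ-injective) j)
  G≡join i j = begin
    G i j                                        ≡⟨ G≡joinAdj-index i j ⟩
    joinAdj m (index i) (index j)                ≡⟨ sym (cong₂ (joinAdj m) (toℕ-φ i) (toℕ-φ j)) ⟩
    joinAdj m (toℕ (φ i)) (toℕ (φ j))            ≡⟨ sym (join≡joinAdj m t (φ i) (φ j)) ⟩
    join (Hhat m) (Complete (t + t)) (φ i) (φ j) ≡⟨ sym (cong₂ (join (Hhat m) (Complete (t + t))) (injection↔-to size φ φ-injective i) (injection↔-to size φ φ-injective j)) ⟩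
    _                                            ∎
    where open ≡-Reasoning

record TightForcingSet {n : ℕ} (G : Graph (2 * n)) (k : ℕ) : Set where
  field
    matching   : PerfectMatching G
    covered    : Subset (2 * n)
    forcing    : IsForcingSet matching covered
    size       : edgesOf matching covered ≡ k
    boundTight : BoundTight n (edgeCount G) k

extremal⇒tightForcingSet : ∀ {n k} (G : Graph (2 * n)) → IsSimple G → k < n →
  G ≅ join (Hhat (n ∸ k)) (Complete (k + k)) → TightForcingSet G k
extremal⇒tightForcingSet {n} {k} G simp k<n (ψ , G≡) = record
  { matching = E.matchingₑ ; covered = E.coveredₑ ; forcing = E.forcingₑ
  ; size = E.edgesOf-coveredₑ ; boundTight = k<n , tight }
  where
  module E = ExtremalForcing {n} G simp k ψ G≡
  module B = Bound {n} G simp E.matchingₑ E.coveredₑ E.forcingₑ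
  tight : (2 * n ∸ (1 + 2 * k)) ^ 2 + 4 * edgeCount G ≡ 4 * n * (2 * n ∸ 1) + 1
  tight = subst (λ z → (2 * n ∸ (1 + 2 * z)) ^ 2 + 4 * edgeCount G ≡ 4 * n * (2 * n ∸ 1) + 1) E.edgesOf-coveredₑ
    (trans (sym (+-identityʳ lhs)) (trans (cong (lhs +_) (sym E.gapsₑ≡0)) (B.bound-identity (subst (_< n) (sym E.edgesOf-coveredₑ) k<n))))
    where lhs = (2 * n ∸ (1 + 2 * B.t)) ^ 2 + 4 * edgeCount G

corollary2p2 : (n : ℕ) (G : Graph (2 * n)) → IsSimple G → PerfectMatching G →
    (f : ℕ) → IsForcingNumber G f →
    BoundHolds n (edgeCount G) f ×
    (BoundTight n (edgeCount G) f ⇔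
    Σ ℕ (λ k → k < n × (G ≅ join (Hhat (n ∸ k)) (Complete (k + k)))))
corollary2p2 n G simp _ f ((M , (T , forcing , |T|≡f) , _) , minimal) =
  subst (BoundHolds n (edgeCount G)) |T|≡f (forcingSet-boundHolds G simp M T forcing) , mk⇔ to from
  where
  to : BoundTight n (edgeCount G) f → Σ ℕ (λ k → k < n × (G ≅ join (Hhat (n ∸ k)) (Complete (k + k))))
  to tight = f , proj₁ tight ,
    subst (λ k → G ≅ join (Hhat (n ∸ k)) (Complete (k + k))) |T|≡f
      (boundTight⇒extremal G simp M T forcing (subst (BoundTight n (edgeCount G)) (sym |T|≡f) tight))
  from : Σ ℕ (λ k → k < n × (G ≅ join (Hhat (n ∸ k)) (Complete (k + k)))) → BoundTight n (edgeCount G) f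
  from (k , k<n , G≅) = subst (BoundTight n (edgeCount G)) (sym (≤-antisym f≤k k≤f)) W.boundTight
    where
    module W = TightForcingSet (extremal⇒tightForcingSet G simp k<n G≅)
    f≤k : f ≤ k
    f≤k = minimal W.matching k ((W.covered , W.forcing , W.size) , boundTight⇒≤forcingSet G simp W.boundTight W.matching)
    k≤f : k ≤ f
    k≤f = subst (k ≤_) |T|≡f (boundTight⇒≤forcingSet G simp W.boundTight M T forcing)
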